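{- Let $O$ be the origin of $\mathbb{R}^4$. (i) Let $P,Q\in\mathbb{Z}^4$ be such that $O,P,Q$ are pairwise at the same Euclidean distance, and let $m,n\in\mathbb{Z}$. Define $P',Q'\in\mathbb{Z}^4$ by $\overrightarrow{OP'}=m\overrightarrow{OP}-n\overrightarrow{OQ}$ and $\overrightarrow{OQ'}=(m-n)\overrightarrow{OQ}+n\overrightarrow{OP}$. Then $O,P',Q'$ are pairwise at the same distance, and this common distance equals $|\overrightarrow{PQ}|\sqrt{m^2-mn+n^2}$. (ii) If moreover $P\neq O$ (so $OPQ$ is a nondegenerate equilateral triangle), then there exists an equilateral triangle $ORS$ with $R,S\in\mathbb{Z}^4$ lying in the plane spanned by $P$ and $Q$ which is minimal, i.e. every equilateral triangle in this plane having $O$ as a vertex and its other two vertices in $\mathbb{Z}^4$ has vertex set $\{O,\,mR-nS,\,nR+(m-n)S\}$ for some integers $m,n$. (iii) With $P\ne O$ and $P',Q'$ as in (i): if the triangle $OP'Q'$ is irreducible, then $\gcd(m,n)=1$. Conversely, if $OPQ$ is minimal (in the sense of (ii), i.e. every equilateral triangle in the plane spanned by $P,Q$ with vertex $O$ and other vertices in $\mathbb{Z}^4$ has vertex set $\{O,\,mP-nQ,\,nP+(m-n)Q\}$ for some integers $m,n$) and $\gcd(m,n)=1$, then $OP'Q'$ is irreducible. (iv) If $OPQ$ (with $P\neq O$) is irreducible and $|\overrightarrow{PQ}|^2$ is divisible neither by $3$ nor by any prime of the form $6k+1$, then $OPQ$ is minimal in the sense of (ii).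
   Context: An equilateral triangle $OXY$ with $X,Y\in\mathbb{Z}^4$ means that the three Euclidean distances $|OX|,|OY|,|XY|$ are equal and positive. Such a triangle (with $O$ the origin) is irreducible if there is no integer $t\ge 2$ such that $X/t$ and $Y/t$ both lie in $\mathbb{Z}^4$. -}

module Defs where

open import Data.Nat as ℕ using (ℕ)
open import Data.Nat.Divisibility as ℕ using ()
open import Data.Integer as ℤ using (ℤ; +_; _+_; _-_; _*_; _<_)
open import Data.Integer.GCD using (gcd)
open import Data.Nat.Primality using (Prime)
open import Data.Vec using (Vec; zipWith; map; replicate; foldr)
open import Data.Product using (Σ; ∃; ∃-syntax; _×_; _,_)
open import Data.Sum using (_⊎_)
open import Relation.Binary.PropositionalEquality using (_≡_; _≢_)
open import Relation.Nullary using (¬_)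

ℤ⁴ : Set
ℤ⁴ = Vec ℤ 4

O : ℤ⁴
O = replicate 4 (+ 0)

infixl 6 _⊕_ _⊖_
infixl 7 _·_

_⊕_ : ℤ⁴ → ℤ⁴ → ℤ⁴
_⊕_ = zipWith _+_

_⊖_ : ℤ⁴ → ℤ⁴ → ℤ⁴
_⊖_ = zipWith _-_

_·_ : ℤ → ℤ⁴ → ℤ⁴
k · v = map (k *_) v

‖_‖² : ℤ⁴ → ℤ
‖ v ‖² = foldr _ _+_ (+ 0) (map (λ x → x * x) v)

EqDist : ℤ⁴ → ℤ⁴ → Set
EqDist X Y = (‖ X ‖² ≡ ‖ Y ‖²) × (‖ Y ‖² ≡ ‖ X ⊖ Y ‖²)

Equilateral : ℤ⁴ → ℤ⁴ → Set
Equilateral X Y = EqDist X Y × (+ 0 < ‖ X ‖²)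

-- X lies in the (real) plane spanned by P and Q; for integer points this is
-- the rational span: c X = a P + b Q with c ≠ 0.
InPlane : ℤ⁴ → ℤ⁴ → ℤ⁴ → Set
InPlane P Q X = ∃[ a ] ∃[ b ] ∃[ c ] ((c ≢ + 0) × (c · X ≡ a · P ⊕ b · Q))

P′ : ℤ → ℤ → ℤ⁴ → ℤ⁴ → ℤ⁴
P′ m n P Q = m · P ⊖ n · Q

Q′ : ℤ → ℤ → ℤ⁴ → ℤ⁴ → ℤ⁴
Q′ m n P Q = (m - n) · Q ⊕ n · P

GeneratedBy : ℤ⁴ → ℤ⁴ → ℤ⁴ → ℤ⁴ → Set
GeneratedBy R S X Y = ∃[ m ] ∃[ n ]
  (((X ≡ P′ m n R S) × (Y ≡ Q′ m n R S)) ⊎ ((X ≡ Q′ m n R S) × (Y ≡ P′ m n R S)))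

MinimalIn : ℤ⁴ → ℤ⁴ → ℤ⁴ → ℤ⁴ → Set
MinimalIn P Q R S =
  InPlane P Q R × InPlane P Q S × Equilateral R S ×
  (∀ X Y → InPlane P Q X → InPlane P Q Y → Equilateral X Y → GeneratedBy R S X Y)

Irreducible : ℤ⁴ → ℤ⁴ → Set
Irreducible X Y = ¬ (∃[ t ] ((2 ℕ.≤ t) × (∃[ X₀ ] (X ≡ (+ t) · X₀)) × (∃[ Y₀ ] (Y ≡ (+ t) · Y₀))))

No3Or6k+1Factor : ℤ → Set
No3Or6k+1Factor d =
  ¬ (3 ℕ.∣ ℤ.∣ d ∣) × (∀ k → Prime (6 ℕ.* k ℕ.+ 1) → ¬ ((6 ℕ.* k ℕ.+ 1) ℕ.∣ ℤ.∣ d ∣))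

-- Coordinates in the basis P, Q of an equilateral triangle OPQ behave like Eisenstein integers
-- a + bω: with e = ⟨P, Q⟩ one has ‖aP + bQ‖² = 2e·N(a, b), N(a, b) = a² + ab + b², and turning OX
-- through 60° multiplies its coordinate by ω. Part (i) is N(m - nω) = m² - mn + n².
-- The coordinates of the integral points X whose 60° rotation is integral as well form an ideal
-- of the Euclidean ring ℤ[ω]; an element of least norm, found by a finite search, generates it and
-- gives the minimal triangle of (ii). For (iii), a common factor of m and n scales OP′Q′ down, and
-- conversely a scaling t of OP′Q′ is generated by the minimal OPQ, so t divides m and n. For (iv),
-- if OPQ = κ·ORS with ORS minimal then N κ divides |PQ|², so every prime factor p of N κ is
-- ≡ 2 (mod 3); such a p has no primitive cube root of unity mod p (Fermat), hence p divides κ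
-- and then both P and Q. So N κ = 1 and OPQ is itself minimal.

module Submission where

open import Defs
open import Data.Integer using (ℤ; +_; _-_; _+_; _*_)
open import Data.Integer.GCD using (gcd)
open import Data.Product using (_×_; ∃-syntax)
open import Relation.Binary.PropositionalEquality using (_≡_; _≢_)

open import Data.Empty using (⊥; ⊥-elim)
open import Data.Integer as ℤ using (-_; -[1+_]; _≤_; _<_; ∣_∣; _^_)
import Data.Integer.DivMod as ℤ
import Data.Integer.GCD as ℤ
import Data.Integer.Properties as ℤ
open import Data.Integer.Divisibility.Signed using (_∣_; divides; _∣?_; ∣ᵤ⇒∣; ∣⇒∣ᵤ; ∣m∣n⇒∣m+n; ∣m⇒∣-m; ∣n⇒∣m*n; ∣m∣n⇒∣m-n)
open import Data.Integer.Tactic.RingSolver using (solve-∀)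
open import Data.List as List using (List; []; _∷_; _++_; upTo; filter; cartesianProduct)
open import Data.List.Extrema ℤ.≤-totalOrder using (argmin; argmin-all; f[argmin]≤f[⊤]; f[argmin]≤f[xs])
open import Data.List.Membership.Propositional using (_∈_)
open import Data.List.Membership.Propositional.Properties using (∈-map⁺; ∈-++⁺ˡ; ∈-++⁺ʳ; ∈-upTo⁺; ∈-cartesianProduct⁺; ∈-filter⁺)
open import Data.List.Relation.Unary.All using (_∷_; lookup)
open import Data.List.Relation.Unary.All.Properties using (all-filter)
open import Data.Nat as ℕ using (ℕ; zero; suc; _!)
import Data.Nat.DivMod as ℕ
import Data.Nat.Divisibility as ℕ
import Data.Nat.GCD as ℕ
import Data.Nat.Properties as ℕ
import Data.Nat.Tactic.RingSolver as ℕ-Solver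
open import Data.Nat.Combinatorics using (_C_; nCn≡1; nCk+nC[k+1]≡[n+1]C[k+1]; nCk≡nC[n∸k]; k![n∸k]!∣n!)
open import Data.Nat.Combinatorics.Specification using (nCk≡n!/k![n-k]!; k>n⇒nCk≡0)
open import Data.Nat.ListAction using (product)
open import Data.Nat.Primality using (Prime; euclidsLemma; prime⇒nonTrivial; prime⇒irreducible)
open import Data.Nat.Primality.Factorisation using (factorise)
open import Data.Product using (_,_; proj₁; proj₂; map₂; swap)
open import Data.Product.Properties using (≡-dec)
open import Data.Sum using (_⊎_; inj₁; inj₂; [_,_]′)
open import Data.Vec using (Vec; []; _∷_; zipWith; map; foldr; replicate)
open import Data.Vec.Properties using (∷-injective; ∷-injectiveˡ; ∷-injectiveʳ)
open import Function using (_∘_; id)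
open import Relation.Binary.Bundles using (Setoid)
open import Relation.Binary.Definitions using (DecidableEquality)
open import Relation.Binary.PropositionalEquality using (refl; sym; trans; cong; cong₂; subst; subst₂; module ≡-Reasoning)
open import Relation.Nullary using (¬_; Dec; yes; no; ¬?; _×-dec_)
open import Relation.Nullary.Decidable using (decidable-stable; map′)
open import Relation.Unary using (Decidable)

-- Integer vectors and their inner product

*-cancelˡ : ∀ c {x y} → c ≢ + 0 → c * x ≡ c * y → x ≡ y
*-cancelˡ c {x} {y} c≢0 = ℤ.*-cancelˡ-≡ c x y {{ℤ.≢-nonZero c≢0}}

*-≢0 : ∀ {i j} → i ≢ + 0 → j ≢ + 0 → i * j ≢ + 0
*-≢0 {i} i≢0 j≢0 ij≡0 with ℤ.i*j≡0⇒i≡0∨j≡0 i ij≡0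
... | inj₁ i≡0 = i≢0 i≡0
... | inj₂ j≡0 = j≢0 j≡0

0≤i*i : ∀ i → + 0 ≤ i * i
0≤i*i (+ zero)  = ℤ.+≤+ ℕ.z≤n
0≤i*i (+ suc n) = ℤ.+≤+ ℕ.z≤n
0≤i*i -[1+ n ]  = ℤ.+≤+ ℕ.z≤n

i*i≡0⇒i≡0 : ∀ i → i * i ≡ + 0 → i ≡ + 0
i*i≡0⇒i≡0 i ii≡0 with ℤ.i*j≡0⇒i≡0∨j≡0 i ii≡0
... | inj₁ i≡0 = i≡0
... | inj₂ i≡0 = i≡0

0≤+ : ∀ {i j} → + 0 ≤ i → + 0 ≤ j → + 0 ≤ i + j
0≤+ = ℤ.+-mono-≤

+≡0-nonNeg : ∀ {i j} → + 0 ≤ i → + 0 ≤ j → i + j ≡ + 0 → i ≡ + 0 × j ≡ + 0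
+≡0-nonNeg (ℤ.+≤+ _) (ℤ.+≤+ _) i+j≡0 = cong +_ (ℕ.m+n≡0⇒m≡0 _ a+b≡0) , cong +_ (ℕ.m+n≡0⇒n≡0 _ a+b≡0)
  where a+b≡0 = ℤ.+-injective i+j≡0

componentwise₁ : {f g : ℤ → ℤ} → (∀ x → f x ≡ g x) → (X : ℤ⁴) → map f X ≡ map g X
componentwise₁ f≗g (x₁ ∷ x₂ ∷ x₃ ∷ x₄ ∷ []) =
  cong₂ _∷_ (f≗g x₁) (cong₂ _∷_ (f≗g x₂) (cong₂ _∷_ (f≗g x₃) (cong₂ _∷_ (f≗g x₄) refl)))

componentwise : {f g : ℤ → ℤ → ℤ} → (∀ x y → f x y ≡ g x y) → (X Y : ℤ⁴) → zipWith f X Y ≡ zipWith g X Y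
componentwise f≗g (x₁ ∷ x₂ ∷ x₃ ∷ x₄ ∷ []) (y₁ ∷ y₂ ∷ y₃ ∷ y₄ ∷ []) =
  cong₂ _∷_ (f≗g x₁ y₁) (cong₂ _∷_ (f≗g x₂ y₂) (cong₂ _∷_ (f≗g x₃ y₃) (cong₂ _∷_ (f≗g x₄ y₄) refl)))

·-cancelˡ : ∀ c {X Y} → c ≢ + 0 → c · X ≡ c · Y → X ≡ Y
·-cancelˡ c {X} {Y} c≢0 = scaled-injective X Y
  where
  scaled-injective : ∀ {k} (X Y : Vec ℤ k) → map (c *_) X ≡ map (c *_) Y → X ≡ Y
  scaled-injective []      []      _  = refl
  scaled-injective (x ∷ X) (y ∷ Y) eq with ∷-injective eq
  ... | cx≡cy , cX≡cY = cong₂ _∷_ (*-cancelˡ c c≢0 cx≡cy) (scaled-injective X Y cX≡cY)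

sumSquares : ∀ {k} → Vec ℤ k → ℤ
sumSquares X = foldr (λ _ → ℤ) _+_ (+ 0) (map (λ x → x * x) X)

0≤sumSquares : ∀ {k} (X : Vec ℤ k) → + 0 ≤ sumSquares X
0≤sumSquares []      = ℤ.≤-refl
0≤sumSquares (x ∷ X) = 0≤+ (0≤i*i x) (0≤sumSquares X)

sumSquares≡0⇒≡0 : ∀ {k} (X : Vec ℤ k) → sumSquares X ≡ + 0 → X ≡ replicate k (+ 0)
sumSquares≡0⇒≡0 []      _  = refl
sumSquares≡0⇒≡0 (x ∷ X) eq with +≡0-nonNeg (0≤i*i x) (0≤sumSquares X) eq
... | x²≡0 , rest≡0 = cong₂ _∷_ (i*i≡0⇒i≡0 x x²≡0) (sumSquares≡0⇒≡0 X rest≡0)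

0≤‖‖² : ∀ X → + 0 ≤ ‖ X ‖²
0≤‖‖² = 0≤sumSquares

‖‖²≡0⇒≡O : ∀ X → ‖ X ‖² ≡ + 0 → X ≡ O
‖‖²≡0⇒≡O = sumSquares≡0⇒≡0

⟨_,_⟩ : ∀ {k} → Vec ℤ k → Vec ℤ k → ℤ
⟨ []    , []    ⟩ = + 0
⟨ x ∷ X , y ∷ Y ⟩ = x * y + ⟨ X , Y ⟩

‖‖²≡⟨⟩ : ∀ X → ‖ X ‖² ≡ ⟨ X , X ⟩
‖‖²≡⟨⟩ (_ ∷ _ ∷ _ ∷ _ ∷ []) = refl

⟨⟩-comm : ∀ {k} (X Y : Vec ℤ k) → ⟨ X , Y ⟩ ≡ ⟨ Y , X ⟩
⟨⟩-comm []      []      = refl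
⟨⟩-comm (x ∷ X) (y ∷ Y) = cong₂ _+_ (ℤ.*-comm x y) (⟨⟩-comm X Y)

⟨⊕⟩ˡ : ∀ X Y Z → ⟨ X ⊕ Y , Z ⟩ ≡ ⟨ X , Z ⟩ + ⟨ Y , Z ⟩
⟨⊕⟩ˡ = additive
  where
  step : ∀ x y z a b → (x + y) * z + (a + b) ≡ (x * z + a) + (y * z + b)
  step = solve-∀
  additive : ∀ {k} (X Y Z : Vec ℤ k) → ⟨ zipWith _+_ X Y , Z ⟩ ≡ ⟨ X , Z ⟩ + ⟨ Y , Z ⟩
  additive []      []      []      = refl
  additive (x ∷ X) (y ∷ Y) (z ∷ Z) = trans (cong (λ r → (x + y) * z + r) (additive X Y Z)) (step x y z _ _)

⟨⊖⟩ˡ : ∀ X Y Z → ⟨ X ⊖ Y , Z ⟩ ≡ ⟨ X , Z ⟩ - ⟨ Y , Z ⟩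
⟨⊖⟩ˡ = subtractive
  where
  step : ∀ x y z a b → (x - y) * z + (a - b) ≡ (x * z + a) - (y * z + b)
  step = solve-∀
  subtractive : ∀ {k} (X Y Z : Vec ℤ k) → ⟨ zipWith _-_ X Y , Z ⟩ ≡ ⟨ X , Z ⟩ - ⟨ Y , Z ⟩
  subtractive []      []      []      = refl
  subtractive (x ∷ X) (y ∷ Y) (z ∷ Z) = trans (cong (λ r → (x - y) * z + r) (subtractive X Y Z)) (step x y z _ _)

⟨·⟩ˡ : ∀ c X Y → ⟨ c · X , Y ⟩ ≡ c * ⟨ X , Y ⟩
⟨·⟩ˡ c = homogeneous
  where
  step : ∀ c x y a → c * x * y + c * a ≡ c * (x * y + a)
  step = solve-∀
  homogeneous : ∀ {k} (X Y : Vec ℤ k) → ⟨ map (c *_) X , Y ⟩ ≡ c * ⟨ X , Y ⟩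
  homogeneous []      []      = sym (ℤ.*-zeroʳ c)
  homogeneous (x ∷ X) (y ∷ Y) = trans (cong (λ r → c * x * y + r) (homogeneous X Y)) (step c x y _)

‖·‖² : ∀ t X → ‖ t · X ‖² ≡ t * t * ‖ X ‖²
‖·‖² t X = begin
  ‖ t · X ‖²              ≡⟨ ‖‖²≡⟨⟩ (t · X) ⟩
  ⟨ t · X , t · X ⟩       ≡⟨ ⟨·⟩ˡ t X (t · X) ⟩
  t * ⟨ X , t · X ⟩       ≡⟨ cong (t *_) (trans (⟨⟩-comm X (t · X)) (⟨·⟩ˡ t X X)) ⟩
  t * (t * ⟨ X , X ⟩)     ≡⟨ sym (ℤ.*-assoc t t _) ⟩
  t * t * ⟨ X , X ⟩       ≡⟨ cong (t * t *_) (sym (‖‖²≡⟨⟩ X)) ⟩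
  t * t * ‖ X ‖²          ∎
  where open ≡-Reasoning

‖⊖‖² : ∀ X Y → ‖ X ⊖ Y ‖² ≡ ‖ X ‖² - + 2 * ⟨ X , Y ⟩ + ‖ Y ‖²
‖⊖‖² X Y = begin
  ‖ X ⊖ Y ‖²                                              ≡⟨ ‖‖²≡⟨⟩ (X ⊖ Y) ⟩
  ⟨ X ⊖ Y , X ⊖ Y ⟩                                       ≡⟨ ⟨⊖⟩ˡ X Y (X ⊖ Y) ⟩
  ⟨ X , X ⊖ Y ⟩ - ⟨ Y , X ⊖ Y ⟩                           ≡⟨ cong₂ _-_ (expand X) (expand Y) ⟩
  (⟨ X , X ⟩ - ⟨ Y , X ⟩) - (⟨ X , Y ⟩ - ⟨ Y , Y ⟩)       ≡⟨ cong (λ z → (⟨ X , X ⟩ - z) - (⟨ X , Y ⟩ - ⟨ Y , Y ⟩)) (⟨⟩-comm Y X) ⟩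
  (⟨ X , X ⟩ - ⟨ X , Y ⟩) - (⟨ X , Y ⟩ - ⟨ Y , Y ⟩)       ≡⟨ regroup ⟨ X , X ⟩ ⟨ X , Y ⟩ ⟨ Y , Y ⟩ ⟩
  ⟨ X , X ⟩ - + 2 * ⟨ X , Y ⟩ + ⟨ Y , Y ⟩                 ≡⟨ cong₂ (λ a b → a - + 2 * ⟨ X , Y ⟩ + b) (sym (‖‖²≡⟨⟩ X)) (sym (‖‖²≡⟨⟩ Y)) ⟩
  ‖ X ‖² - + 2 * ⟨ X , Y ⟩ + ‖ Y ‖²                       ∎
  where
  open ≡-Reasoning
  expand : ∀ Z → ⟨ Z , X ⊖ Y ⟩ ≡ ⟨ X , Z ⟩ - ⟨ Y , Z ⟩
  expand Z = trans (⟨⟩-comm Z (X ⊖ Y)) (⟨⊖⟩ˡ X Y Z)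
  regroup : ∀ a b c → (a - b) - (b - c) ≡ a - + 2 * b + c
  regroup = solve-∀

eqDist⇒2⟨⟩≡‖‖² : ∀ {X Y} → EqDist X Y → + 2 * ⟨ X , Y ⟩ ≡ ‖ X ‖²
eqDist⇒2⟨⟩≡‖‖² {X} {Y} (‖X‖≡‖Y‖ , ‖Y‖≡‖X⊖Y‖) = solve-for (‖ X ‖²) (+ 2 * ⟨ X , Y ⟩) (begin
  ‖ X ‖²                                     ≡⟨ trans ‖X‖≡‖Y‖ ‖Y‖≡‖X⊖Y‖ ⟩
  ‖ X ⊖ Y ‖²                                 ≡⟨ ‖⊖‖² X Y ⟩
  ‖ X ‖² - + 2 * ⟨ X , Y ⟩ + ‖ Y ‖²          ≡⟨ cong (λ r → ‖ X ‖² - + 2 * ⟨ X , Y ⟩ + r) (sym ‖X‖≡‖Y‖) ⟩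
  ‖ X ‖² - + 2 * ⟨ X , Y ⟩ + ‖ X ‖²          ∎)
  where
  open ≡-Reasoning
  solve-for : ∀ a b → a ≡ a - b + a → b ≡ a
  solve-for a b eq = trans (rearrange a b) (trans (cong (λ r → a + a - r) (sym eq)) (cancel a))
    where
    rearrange : ∀ a b → b ≡ a + a - (a - b + a)
    rearrange = solve-∀
    cancel : ∀ a → a + a - a ≡ a
    cancel = solve-∀

-- The Eisenstein integers

-- (a , b) stands for a + bω with ω = e^{iπ/3}, so that ω² = ω - 1 and N is the norm |a + bω|²;
-- ρ is multiplication by ω and conj is complex conjugation.
ℤ[ω] : Set
ℤ[ω] = ℤ × ℤ

0ω : ℤ[ω]
0ω = + 0 , + 0

infixl 6 _⊞_ _⊟_
infixl 7 _⊡_ _⊠_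
infix 4 _≟ω_

_⊞_ : ℤ[ω] → ℤ[ω] → ℤ[ω]
(a , b) ⊞ (c , d) = a + c , b + d

_⊟_ : ℤ[ω] → ℤ[ω] → ℤ[ω]
(a , b) ⊟ (c , d) = a - c , b - d

_⊡_ : ℤ → ℤ[ω] → ℤ[ω]
k ⊡ (a , b) = k * a , k * b

_⊠_ : ℤ[ω] → ℤ[ω] → ℤ[ω]
(a , b) ⊠ (c , d) = a * c - b * d , a * d + b * c + b * d

ρ : ℤ[ω] → ℤ[ω]
ρ (a , b) = - b , a + b

ρ⁻¹ : ℤ[ω] → ℤ[ω]
ρ⁻¹ (a , b) = a + b , - a

conj : ℤ[ω] → ℤ[ω]
conj (a , b) = a + b , - b

N : ℤ[ω] → ℤ
N (a , b) = a * a + a * b + b * b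

-- The polarisation B x y = N (x ⊞ y) - N x - N y of the norm.
B : ℤ[ω] → ℤ[ω] → ℤ
B (a , b) (c , d) = + 2 * a * c + a * d + b * c + + 2 * b * d

_≟ω_ : DecidableEquality ℤ[ω]
_≟ω_ = ≡-dec ℤ._≟_ ℤ._≟_

⊟≡0ω⇒≡ : ∀ x y → x ⊟ y ≡ 0ω → x ≡ y
⊟≡0ω⇒≡ (a , b) (c , d) eq = cong₂ _,_ (ℤ.i-j≡0⇒i≡j a c (cong proj₁ eq)) (ℤ.i-j≡0⇒i≡j b d (cong proj₂ eq))

ρ-⊠ : ∀ κ x → ρ (κ ⊠ x) ≡ κ ⊠ ρ x
ρ-⊠ (k , l) (a , b) = cong₂ _,_ (first k l a b) (second k l a b)
  where
  first : ∀ k l a b → - (k * b + l * a + l * b) ≡ k * - b - l * (a + b)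
  first = solve-∀
  second : ∀ k l a b → k * a - l * b + (k * b + l * a + l * b) ≡ k * (a + b) + l * - b + l * (a + b)
  second = solve-∀

ρ-⊠ˡ : ∀ κ x → ρ (κ ⊠ x) ≡ ρ κ ⊠ x
ρ-⊠ˡ (k , l) (a , b) = cong₂ _,_ (first k l a b) (second k l a b)
  where
  first : ∀ k l a b → - (k * b + l * a + l * b) ≡ - l * a - (k + l) * b
  first = solve-∀
  second : ∀ k l a b → k * a - l * b + (k * b + l * a + l * b) ≡ - l * b + (k + l) * a + (k + l) * b
  second = solve-∀

ρ-⊟ : ∀ x y → ρ (x ⊟ y) ≡ ρ x ⊟ ρ y
ρ-⊟ (a , b) (c , d) = cong₂ _,_ (first a b c d) (second a b c d)
  where
  first : ∀ a b c d → - (b - d) ≡ - b - - d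
  first = solve-∀
  second : ∀ a b c d → a - c + (b - d) ≡ a + b - (c + d)
  second = solve-∀

⊡-cancelˡ : ∀ c {x y} → c ≢ + 0 → c ⊡ x ≡ c ⊡ y → x ≡ y
⊡-cancelˡ c c≢0 eq = cong₂ _,_ (*-cancelˡ c c≢0 (cong proj₁ eq)) (*-cancelˡ c c≢0 (cong proj₂ eq))

ρ-⊡ : ∀ t x → ρ (t ⊡ x) ≡ t ⊡ ρ x
ρ-⊡ t (a , b) = cong₂ _,_ (ℤ.neg-distribʳ-* t b) (sym (ℤ.*-distribˡ-+ t a b))

ρ² : ∀ x → ρ (ρ x) ≡ ρ x ⊟ x
ρ² (a , b) = cong₂ _,_ (first a b) (second a b)
  where
  first : ∀ a b → - (a + b) ≡ - b - a
  first = solve-∀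
  second : ∀ a b → - b + (a + b) ≡ a + b - b
  second = solve-∀

⊟ρ≡ρ⁻¹ : ∀ x → x ⊟ ρ x ≡ ρ⁻¹ x
⊟ρ≡ρ⁻¹ (a , b) = cong₂ _,_ (cong (λ z → a + z) (ℤ.neg-involutive b)) (second a b)
  where
  second : ∀ a b → b - (a + b) ≡ - a
  second = solve-∀

ρ∘ρ⁻¹ : ∀ x → ρ (ρ⁻¹ x) ≡ x
ρ∘ρ⁻¹ (a , b) = cong₂ _,_ (ℤ.neg-involutive a) (second a b)
  where
  second : ∀ a b → a + b + - a ≡ b
  second = solve-∀

⊠≡⊡⊞⊡ρ : ∀ k l x → (k , l) ⊠ x ≡ k ⊡ x ⊞ l ⊡ ρ x
⊠≡⊡⊞⊡ρ k l (a , b) = cong₂ _,_ (first k l a b) (second k l a b)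
  where
  first : ∀ k l a b → k * a - l * b ≡ k * a + l * - b
  first = solve-∀
  second : ∀ k l a b → k * b + l * a + l * b ≡ k * b + l * (a + b)
  second = solve-∀

⊡-⊠ : ∀ t κ x → (t ⊡ κ) ⊠ x ≡ t ⊡ (κ ⊠ x)
⊡-⊠ t (k , l) (a , b) = cong₂ _,_ (first t k l a b) (second t k l a b)
  where
  first : ∀ t k l a b → t * k * a - t * l * b ≡ t * (k * a - l * b)
  first = solve-∀
  second : ∀ t k l a b → t * k * b + t * l * a + t * l * b ≡ t * (k * b + l * a + l * b)
  second = solve-∀

N-⊠ : ∀ x y → N (x ⊠ y) ≡ N x * N y
N-⊠ (a , b) (c , d) = identity a b c d
  where
  identity : ∀ a b c d →
    (a * c - b * d) * (a * c - b * d) + (a * c - b * d) * (a * d + b * c + b * d) + (a * d + b * c + b * d) * (a * d + b * c + b * d)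
    ≡ (a * a + a * b + b * b) * (c * c + c * d + d * d)
  identity = solve-∀

N-ρ : ∀ x → N (ρ x) ≡ N x
N-ρ (a , b) = identity a b
  where
  identity : ∀ a b → - b * - b + - b * (a + b) + (a + b) * (a + b) ≡ a * a + a * b + b * b
  identity = solve-∀

N-ρ⁻¹ : ∀ x → N (ρ⁻¹ x) ≡ N x
N-ρ⁻¹ x = trans (sym (N-ρ (ρ⁻¹ x))) (cong N (ρ∘ρ⁻¹ x))

N-conj : ∀ x → N (conj x) ≡ N x
N-conj (a , b) = identity a b
  where
  identity : ∀ a b → (a + b) * (a + b) + (a + b) * - b + - b * - b ≡ a * a + a * b + b * b
  identity = solve-∀

B-diag : ∀ x → B x x ≡ + 2 * N x
B-diag (a , b) = identity a b
  where
  identity : ∀ a b → + 2 * a * a + a * b + b * a + + 2 * b * b ≡ + 2 * (a * a + a * b + b * b)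
  identity = solve-∀

private
  4N≡squares : ∀ a b → + 4 * (a * a + a * b + b * b) ≡ (+ 2 * a + b) * (+ 2 * a + b) + (b * b + (b * b + b * b))
  4N≡squares = solve-∀

  0≤squares : ∀ a b → + 0 ≤ (+ 2 * a + b) * (+ 2 * a + b) + (b * b + (b * b + b * b))
  0≤squares a b = 0≤+ (0≤i*i (+ 2 * a + b)) (0≤+ (0≤i*i b) (0≤+ (0≤i*i b) (0≤i*i b)))

0≤N : ∀ x → + 0 ≤ N x
0≤N (a , b) = ℤ.*-cancelˡ-≤-pos (+ 0) (N (a , b)) (+ 4) (subst (+ 0 ≤_) (sym (4N≡squares a b)) (0≤squares a b))

N≡0⇒≡0ω : ∀ x → N x ≡ + 0 → x ≡ 0ω
N≡0⇒≡0ω (a , b) Nx≡0 = cong₂ _,_ a≡0 b≡0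
  where
  squares≡0 : (+ 2 * a + b) * (+ 2 * a + b) + (b * b + (b * b + b * b)) ≡ + 0
  squares≡0 = trans (sym (4N≡squares a b)) (cong (+ 4 *_) Nx≡0)
  split = +≡0-nonNeg (0≤i*i (+ 2 * a + b)) (0≤+ (0≤i*i b) (0≤+ (0≤i*i b) (0≤i*i b))) squares≡0
  b≡0 : b ≡ + 0
  b≡0 = i*i≡0⇒i≡0 b (proj₁ (+≡0-nonNeg (0≤i*i b) (0≤+ (0≤i*i b) (0≤i*i b)) (proj₂ split)))
  a≡0 : a ≡ + 0
  a≡0 = *-cancelˡ (+ 2) (λ ()) (trans (sym (ℤ.+-identityʳ (+ 2 * a))) (trans (cong (λ z → + 2 * a + z) (sym b≡0))
          (i*i≡0⇒i≡0 (+ 2 * a + b) (proj₁ split))))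

∣b∣≤4N : ∀ a b → + ∣ b ∣ ≤ + 4 * N (a , b)
∣b∣≤4N a b = begin
  + ∣ b ∣                                                    ≤⟨ ∣i∣≤i*i b ⟩
  b * b                                                      ≤⟨ ℤ.i≤j+i (b * b) ((+ 2 * a + b) * (+ 2 * a + b)) {{ℤ.nonNegative (0≤i*i (+ 2 * a + b))}} ⟩
  (+ 2 * a + b) * (+ 2 * a + b) + b * b                      ≤⟨ ℤ.+-monoʳ-≤ ((+ 2 * a + b) * (+ 2 * a + b)) (ℤ.i≤i+j (b * b) (b * b + b * b) {{ℤ.nonNegative (0≤+ (0≤i*i b) (0≤i*i b))}}) ⟩
  (+ 2 * a + b) * (+ 2 * a + b) + (b * b + (b * b + b * b))  ≡⟨ sym (4N≡squares a b) ⟩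
  + 4 * N (a , b)                                            ∎
  where
  open ℤ.≤-Reasoning
  ∣i∣≤i*i : ∀ i → + ∣ i ∣ ≤ i * i
  ∣i∣≤i*i (+ zero)  = ℤ.≤-refl
  ∣i∣≤i*i (+ suc n) = ℤ.+≤+ (ℕ.m≤m*n (suc n) (suc n))
  ∣i∣≤i*i -[1+ n ]  = ℤ.+≤+ (ℕ.m≤m*n (suc n) (suc n))

rotation-product : ∀ x y → N (y ⊟ ρ x) * N (y ⊟ ρ⁻¹ x) ≡
  (N x + N y) * (N x + N y) - (N x + N y) * B x y + B x y * B x y - + 3 * N x * N y
rotation-product (p , q) (r , s) = identity p q r s
  where
  identity : ∀ p q r s →
    ((r - - q) * (r - - q) + (r - - q) * (s - (p + q)) + (s - (p + q)) * (s - (p + q))) *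
    ((r - (p + q)) * (r - (p + q)) + (r - (p + q)) * (s - - p) + (s - - p) * (s - - p))
    ≡ ((p * p + p * q + q * q) + (r * r + r * s + s * s)) * ((p * p + p * q + q * q) + (r * r + r * s + s * s))
      - ((p * p + p * q + q * q) + (r * r + r * s + s * s)) * (+ 2 * p * r + p * s + q * r + + 2 * q * s)
      + (+ 2 * p * r + p * s + q * r + + 2 * q * s) * (+ 2 * p * r + p * s + q * r + + 2 * q * s)
      - + 3 * (p * p + p * q + q * q) * (r * r + r * s + s * s)
  identity = solve-∀

-- The product in rotation-product vanishes, so y = ωx or x = ωy.
equal-norm⇒rotation : ∀ x y → N x ≡ N y → B x y ≡ N x → y ≡ ρ x ⊎ x ≡ ρ y
equal-norm⇒rotation x y Nx≡Ny Bxy≡Nx = either (ℤ.i*j≡0⇒i≡0∨j≡0 (N (y ⊟ ρ x)) product≡0)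
  where
  vanishes : ∀ n → (n + n) * (n + n) - (n + n) * n + n * n - + 3 * n * n ≡ + 0
  vanishes = solve-∀
  product≡0 : N (y ⊟ ρ x) * N (y ⊟ ρ⁻¹ x) ≡ + 0
  product≡0 = begin
    N (y ⊟ ρ x) * N (y ⊟ ρ⁻¹ x)                                                   ≡⟨ rotation-product x y ⟩
    (N x + N y) * (N x + N y) - (N x + N y) * B x y + B x y * B x y - + 3 * N x * N y ≡⟨ cong₂ (λ m b → (N x + m) * (N x + m) - (N x + m) * b + b * b - + 3 * N x * m) (sym Nx≡Ny) Bxy≡Nx ⟩
    (N x + N x) * (N x + N x) - (N x + N x) * N x + N x * N x - + 3 * N x * N x     ≡⟨ vanishes (N x) ⟩
    + 0                                                                           ∎
    where open ≡-Reasoning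
  either : N (y ⊟ ρ x) ≡ + 0 ⊎ N (y ⊟ ρ⁻¹ x) ≡ + 0 → y ≡ ρ x ⊎ x ≡ ρ y
  either (inj₁ N≡0) = inj₁ (⊟≡0ω⇒≡ y (ρ x) (N≡0⇒≡0ω _ N≡0))
  either (inj₂ N≡0) = inj₂ (trans (sym (ρ∘ρ⁻¹ x)) (cong ρ (sym (⊟≡0ω⇒≡ y (ρ⁻¹ x) (N≡0⇒≡0ω _ N≡0)))))

nearest-multiple : ∀ s d .{{_ : ℕ.NonZero d}} → ∃[ k ] (∣ + 2 * (s - + d * k) ∣ ℕ.≤ d)
nearest-multiple s d@(suc _) = k , bound
  where
  r = (+ 2 * s + + d) ℤ.%ℕ (2 ℕ.* d)
  k = (+ 2 * s + + d) ℤ./ℕ (2 ℕ.* d)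
  r<2d : r ℕ.< 2 ℕ.* d
  r<2d = ℤ.n%ℕd<d (+ 2 * s + + d) (2 ℕ.* d)
  division : + 2 * s + + d ≡ + r + k * + (2 ℕ.* d)
  division = ℤ.a≡a%ℕn+[a/ℕn]*n (+ 2 * s + + d) (2 ℕ.* d)
  centred : ∀ s d r k → + 2 * s + d ≡ r + k * (+ 2 * d) → + 2 * (s - d * k) ≡ r - d
  centred s d r k eq = trans (identity₁ s d k) (trans (cong (λ z → z - d - k * (+ 2 * d)) eq) (identity₂ r d k))
    where
    identity₁ : ∀ s d k → + 2 * (s - d * k) ≡ + 2 * s + d - d - k * (+ 2 * d)
    identity₁ = solve-∀
    identity₂ : ∀ r d k → r + k * (+ 2 * d) - d - k * (+ 2 * d) ≡ r - d
    identity₂ = solve-∀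
  bound : ∣ + 2 * (s - + d * k) ∣ ℕ.≤ d
  bound rewrite centred s (+ d) (+ r) k (trans division (cong (λ z → + r + k * z) (ℤ.pos-* 2 d)))
              | ℤ.m-n≡m⊖n r d with r ℕ.≤? d
  ... | yes r≤d rewrite ℤ.∣⊖∣-≤ r≤d = ℕ.m∸n≤m d r
  ... | no r≰d rewrite ℤ.⊖-≥ (ℕ.<⇒≤ (ℕ.≰⇒> r≰d)) = ℕ.m≤n+o⇒m∸n≤o r d (subst (r ℕ.≤_) (cong (d ℕ.+_) (ℕ.+-identityʳ d)) (ℕ.<⇒≤ r<2d))

i≤+∣i∣ : ∀ i → i ≤ + ∣ i ∣
i≤+∣i∣ (+ n)    = ℤ.≤-refl
i≤+∣i∣ -[1+ n ] = ℤ.-≤+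

i*j≤∣i∣*∣j∣ : ∀ i j → i * j ≤ + (∣ i ∣ ℕ.* ∣ j ∣)
i*j≤∣i∣*∣j∣ i j = subst (i * j ≤_) (cong +_ (ℤ.abs-* i j)) (i≤+∣i∣ (i * j))

4N≤3D² : ∀ a b D → ∣ + 2 * a ∣ ℕ.≤ D → ∣ + 2 * b ∣ ℕ.≤ D → + 4 * N (a , b) ≤ + (3 ℕ.* (D ℕ.* D))
4N≤3D² a b D ∣u∣≤D ∣v∣≤D = begin
  + 4 * N (a , b)                                                ≡⟨ quadruple a b ⟩
  u * u + u * v + v * v                                          ≤⟨ ℤ.+-mono-≤ (ℤ.+-mono-≤ (i*j≤∣i∣*∣j∣ u u) (i*j≤∣i∣*∣j∣ u v)) (i*j≤∣i∣*∣j∣ v v) ⟩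
  + (∣ u ∣ ℕ.* ∣ u ∣ ℕ.+ ∣ u ∣ ℕ.* ∣ v ∣ ℕ.+ ∣ v ∣ ℕ.* ∣ v ∣)     ≤⟨ ℤ.+≤+ (ℕ.+-mono-≤ (ℕ.+-mono-≤ (ℕ.*-mono-≤ ∣u∣≤D ∣u∣≤D) (ℕ.*-mono-≤ ∣u∣≤D ∣v∣≤D)) (ℕ.*-mono-≤ ∣v∣≤D ∣v∣≤D)) ⟩
  + (D ℕ.* D ℕ.+ D ℕ.* D ℕ.+ D ℕ.* D)                            ≡⟨ cong +_ (thrice (D ℕ.* D)) ⟩
  + (3 ℕ.* (D ℕ.* D))                                            ∎
  where
  open ℤ.≤-Reasoning
  u = + 2 * a
  v = + 2 * b
  quadruple : ∀ a b → + 4 * (a * a + a * b + b * b) ≡ (+ 2 * a) * (+ 2 * a) + (+ 2 * a) * (+ 2 * b) + (+ 2 * b) * (+ 2 * b)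
  quadruple = solve-∀
  thrice : ∀ n → n ℕ.+ n ℕ.+ n ≡ 3 ℕ.* n
  thrice n = trans (ℕ.+-assoc n n n) (cong (λ z → n ℕ.+ (n ℕ.+ z)) (sym (ℕ.+-identityʳ n)))

4nD≤3D²⇒n<D : ∀ n D .{{_ : ℕ.NonZero D}} → 4 ℕ.* (n ℕ.* D) ℕ.≤ 3 ℕ.* (D ℕ.* D) → n ℕ.< D
4nD≤3D²⇒n<D n D 4nD≤3DD with D ℕ.≤? n
... | no  D≰n = ℕ.≰⇒> D≰n
... | yes D≤n = ⊥-elim (ℕ.<⇒≱ 3DD<4DD (ℕ.≤-trans (ℕ.*-monoʳ-≤ 4 (ℕ.*-monoˡ-≤ D D≤n)) 4nD≤3DD))
  where
  3DD<4DD : 3 ℕ.* (D ℕ.* D) ℕ.< 4 ℕ.* (D ℕ.* D)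
  3DD<4DD = ℕ.*-monoˡ-< (D ℕ.* D) {{ℕ.m*n≢0 D D}} (ℕ.n<1+n 3)

remainder-⊠-conj : ∀ x κ g → (x ⊟ κ ⊠ g) ⊠ conj g ≡ x ⊠ conj g ⊟ N g ⊡ κ
remainder-⊠-conj (a , b) (k , l) (c , d) = cong₂ _,_ (first a b k l c d) (second a b k l c d)
  where
  first : ∀ a b k l c d →
    (a - (k * c - l * d)) * (c + d) - (b - (k * d + l * c + l * d)) * - d
    ≡ a * (c + d) - b * - d - (c * c + c * d + d * d) * k
  first = solve-∀
  second : ∀ a b k l c d →
    (a - (k * c - l * d)) * - d + (b - (k * d + l * c + l * d)) * (c + d) + (b - (k * d + l * c + l * d)) * - d
    ≡ a * - d + b * (c + d) + b * - d - (c * c + c * d + d * d) * l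
  second = solve-∀

-- Divide x ⊠ conj g by N g with the quotient rounded to the nearest lattice point.
division-with-norm : ∀ x g d → N g ≡ + suc d → ∃[ κ ] (N (x ⊟ κ ⊠ g) < N g)
division-with-norm x g d Ng≡D = κ , Nr<Ng
  where
  D = suc d
  s = proj₁ (x ⊠ conj g)
  t = proj₂ (x ⊠ conj g)
  k₁ = proj₁ (nearest-multiple s D)
  k₂ = proj₁ (nearest-multiple t D)
  κ = k₁ , k₂
  r = x ⊟ κ ⊠ g
  rounded : ∀ z k → ∣ + 2 * (z - + D * k) ∣ ℕ.≤ D → ∣ + 2 * (z - N g * k) ∣ ℕ.≤ D
  rounded z k = subst (λ c → ∣ + 2 * (z - c * k) ∣ ℕ.≤ D) (sym Ng≡D)
  Nr*Ng≡Ne : N r * N g ≡ N (x ⊠ conj g ⊟ N g ⊡ κ)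
  Nr*Ng≡Ne = begin
    N r * N g          ≡⟨ cong (N r *_) (sym (N-conj g)) ⟩
    N r * N (conj g)   ≡⟨ sym (N-⊠ r (conj g)) ⟩
    N (r ⊠ conj g)     ≡⟨ cong N (remainder-⊠-conj x κ g) ⟩
    N (x ⊠ conj g ⊟ N g ⊡ κ) ∎
    where open ≡-Reasoning
  bound = + (3 ℕ.* (D ℕ.* D))
  4NrD≤3DD : + 4 * (N r * + D) ≤ bound
  4NrD≤3DD = subst (λ c → + 4 * (N r * c) ≤ bound) Ng≡D (subst (λ z → + 4 * z ≤ bound) (sym Nr*Ng≡Ne)
    (4N≤3D² (s - N g * k₁) (t - N g * k₂) D (rounded s k₁ (proj₂ (nearest-multiple s D))) (rounded t k₂ (proj₂ (nearest-multiple t D)))))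
  n = ∣ N r ∣
  Nr≡n : N r ≡ + n
  Nr≡n = sym (ℤ.0≤i⇒+∣i∣≡i (0≤N r))
  4nD≤3DD : 4 ℕ.* (n ℕ.* D) ℕ.≤ 3 ℕ.* (D ℕ.* D)
  4nD≤3DD = ℤ.drop‿+≤+ (subst (_≤ bound) in-ℕ 4NrD≤3DD)
    where
    open ≡-Reasoning
    in-ℕ : + 4 * (N r * + D) ≡ + (4 ℕ.* (n ℕ.* D))
    in-ℕ = begin
      + 4 * (N r * + D)     ≡⟨ cong (λ m → + 4 * (m * + D)) Nr≡n ⟩
      + 4 * (+ n * + D)     ≡⟨ cong (+ 4 *_) (sym (ℤ.pos-* n D)) ⟩
      + 4 * + (n ℕ.* D)     ≡⟨ sym (ℤ.pos-* 4 (n ℕ.* D)) ⟩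
      + (4 ℕ.* (n ℕ.* D))   ∎
  Nr<Ng : N r < N g
  Nr<Ng = subst₂ _<_ (sym Nr≡n) (sym Ng≡D) (ℤ.+<+ (4nD≤3D²⇒n<D n D 4nD≤3DD))

0<N : ∀ {g} → g ≢ 0ω → ∃[ d ] (N g ≡ + suc d)
0<N {g} g≢0 with N g in Ng≡
... | + zero  = ⊥-elim (g≢0 (N≡0⇒≡0ω g Ng≡))
... | + suc d = d , refl
... | -[1+ n ] = ⊥-elim (ℤ.<⇒≱ ℤ.-<+ (subst (+ 0 ≤_) Ng≡ (0≤N g)))

ω-division : ∀ x {g} → g ≢ 0ω → ∃[ κ ] (N (x ⊟ κ ⊠ g) < N g)
ω-division x {g} g≢0 = division-with-norm x g (proj₁ (0<N g≢0)) (proj₂ (0<N g≢0))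

module _ {I : ℤ[ω] → Set} (I-⊟ : ∀ {x y} → I x → I y → I (x ⊟ y)) (I-⊠ : ∀ κ {x} → I x → I (κ ⊠ x)) where

  least-norm-generates : ∀ {g} → I g → g ≢ 0ω → (∀ z → I z → z ≢ 0ω → N g ≤ N z) → ∀ {x} → I x → ∃[ κ ] (x ≡ κ ⊠ g)
  least-norm-generates {g} Ig g≢0 least {x} Ix = κ , ⊟≡0ω⇒≡ x (κ ⊠ g) r≡0
    where
    κ = proj₁ (ω-division x g≢0)
    r≡0 : x ⊟ κ ⊠ g ≡ 0ω
    r≡0 = decidable-stable (x ⊟ κ ⊠ g ≟ω 0ω)
      (λ r≢0 → ℤ.<⇒≱ (proj₂ (ω-division x g≢0)) (least _ (I-⊟ Ix (I-⊠ κ Ig)) r≢0))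

range : ℕ → List ℤ
range n = List.map +_ (upTo (suc n)) ++ List.map -[1+_] (upTo n)

∈-range : ∀ {n} z → ∣ z ∣ ℕ.≤ n → z ∈ range n
∈-range (+ m)    m≤n = ∈-++⁺ˡ (∈-map⁺ +_ (∈-upTo⁺ (ℕ.s≤s m≤n)))
∈-range {n} -[1+ m ] m<n = ∈-++⁺ʳ (List.map +_ (upTo (suc n))) (∈-map⁺ -[1+_] (∈-upTo⁺ m<n))

-- A finite search: nonzero elements of norm at most N g₀ have coordinates bounded by 4 N g₀.
module _ {I : ℤ[ω] → Set} (I? : Decidable I) where

  least-norm-element : ∀ {g₀} → I g₀ → g₀ ≢ 0ω → ∃[ g ] (I g × g ≢ 0ω × (∀ z → I z → z ≢ 0ω → N g ≤ N z))
  least-norm-element {g₀} Ig₀ g₀≢0 = g , proj₁ good-g , proj₂ good-g , least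
    where
    Good : ℤ[ω] → Set
    Good z = I z × z ≢ 0ω
    good? : Decidable Good
    good? z = I? z ×-dec ¬? (z ≟ω 0ω)
    bound : ℕ
    bound = ∣ + 4 * N g₀ ∣
    coordinate-bound : ∀ a b → N (a , b) ≤ N g₀ → ∣ b ∣ ℕ.≤ bound
    coordinate-bound a b Nab≤Ng₀ = ℤ.drop‿+≤+ (ℤ.≤-trans (∣b∣≤4N a b)
      (ℤ.≤-trans (ℤ.*-monoˡ-≤-nonNeg (+ 4) Nab≤Ng₀) (i≤+∣i∣ (+ 4 * N g₀))))
    N-swap : ∀ a b → a * a + a * b + b * b ≡ b * b + b * a + a * a
    N-swap = solve-∀
    box : List ℤ[ω]
    box = cartesianProduct (range bound) (range bound)
    candidates : List ℤ[ω]
    candidates = filter good? box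
    small⇒candidate : ∀ z → N z ≤ N g₀ → Good z → z ∈ candidates
    small⇒candidate (a , b) Nz≤Ng₀ = ∈-filter⁺ good? (∈-cartesianProduct⁺
      (∈-range a (coordinate-bound b a (subst (_≤ N g₀) (N-swap a b) Nz≤Ng₀))) (∈-range b (coordinate-bound a b Nz≤Ng₀)))
    g : ℤ[ω]
    g = argmin N g₀ candidates
    good-g : Good g
    good-g = argmin-all N (Ig₀ , g₀≢0) (all-filter good? box)
    least : ∀ z → I z → z ≢ 0ω → N g ≤ N z
    least z Iz z≢0 with N z ℤ.≤? N g₀
    ... | yes Nz≤Ng₀ = lookup (f[argmin]≤f[xs] {f = N} g₀ candidates) (small⇒candidate z Nz≤Ng₀ (Iz , z≢0))
    ... | no  Nz≰Ng₀ = ℤ.≤-trans (f[argmin]≤f[⊤] {f = N} g₀ candidates) (ℤ.<⇒≤ (ℤ.≰⇒> Nz≰Ng₀))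

-- Fermat's little theorem and primes p ≡ 2 (mod 3)

partial-binomial : ℕ → ℕ → ℕ → ℕ
partial-binomial n x zero    = 0
partial-binomial n x (suc k) = partial-binomial n x k ℕ.+ (n C k) ℕ.* x ℕ.^ k

nC0≡1 : ∀ n → n C 0 ≡ 1
nC0≡1 n = trans (nCk≡nC[n∸k] {n = n} ℕ.z≤n) (nCn≡1 n)

pascal-partial : ∀ n x k → partial-binomial (suc n) x (suc k) ≡ partial-binomial n x (suc k) ℕ.+ x ℕ.* partial-binomial n x k
pascal-partial n x zero rewrite nC0≡1 n | nC0≡1 (suc n) = sym (cong (1 ℕ.+_) (ℕ.*-zeroʳ x))
pascal-partial n x (suc k) = begin
  partial-binomial (suc n) x (suc k) ℕ.+ (suc n C suc k) ℕ.* (x ℕ.* x ℕ.^ k)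
    ≡⟨ cong₂ (λ a b → a ℕ.+ b ℕ.* (x ℕ.* x ℕ.^ k)) (pascal-partial n x k) (sym (nCk+nC[k+1]≡[n+1]C[k+1] n k)) ⟩
  (Sₖ₊₁ ℕ.+ x ℕ.* Sₖ) ℕ.+ ((n C k) ℕ.+ (n C suc k)) ℕ.* (x ℕ.* x ℕ.^ k)
    ≡⟨ regroup Sₖ₊₁ Sₖ (n C k) (n C suc k) x (x ℕ.^ k) ⟩
  (Sₖ₊₁ ℕ.+ (n C suc k) ℕ.* (x ℕ.* x ℕ.^ k)) ℕ.+ x ℕ.* (Sₖ ℕ.+ (n C k) ℕ.* x ℕ.^ k) ∎
  where
  open ≡-Reasoning
  Sₖ₊₁ = partial-binomial n x (suc k)
  Sₖ = partial-binomial n x k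
  regroup : ∀ A B c₁ c₂ x y → (A ℕ.+ x ℕ.* B) ℕ.+ (c₁ ℕ.+ c₂) ℕ.* (x ℕ.* y) ≡ (A ℕ.+ c₂ ℕ.* (x ℕ.* y)) ℕ.+ x ℕ.* (B ℕ.+ c₁ ℕ.* y)
  regroup = ℕ-Solver.solve-∀

binomial-theorem : ∀ n x → (x ℕ.+ 1) ℕ.^ n ≡ partial-binomial n x (suc n)
binomial-theorem zero    x = refl
binomial-theorem (suc n) x = begin
  (x ℕ.+ 1) ℕ.* (x ℕ.+ 1) ℕ.^ n                          ≡⟨ cong ((x ℕ.+ 1) ℕ.*_) (binomial-theorem n x) ⟩
  (x ℕ.+ 1) ℕ.* S                                        ≡⟨ expand x S ⟩
  (S ℕ.+ 0) ℕ.+ x ℕ.* S                                  ≡⟨ cong (λ c → (S ℕ.+ c ℕ.* x ℕ.^ suc n) ℕ.+ x ℕ.* S) (sym (k>n⇒nCk≡0 (ℕ.n<1+n n))) ⟩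
  partial-binomial n x (suc (suc n)) ℕ.+ x ℕ.* S         ≡⟨ sym (pascal-partial n x (suc n)) ⟩
  partial-binomial (suc n) x (suc (suc n))               ∎
  where
  open ≡-Reasoning
  S = partial-binomial n x (suc n)
  expand : ∀ x S → (x ℕ.+ 1) ℕ.* S ≡ (S ℕ.+ 0) ℕ.+ x ℕ.* S
  expand = ℕ-Solver.solve-∀

module Modulo (p : ℕ) where

  infix 4 _≋_
  record _≋_ (x y : ℤ) : Set where
    constructor mod-p
    field difference : + p ∣ x - y
  open _≋_ public

  ≋-reflexive : ∀ {x y} → x ≡ y → x ≋ y
  ≋-reflexive {x} refl = mod-p (divides (+ 0) (ℤ.+-inverseʳ x))

  ≋-refl : ∀ x → x ≋ x
  ≋-refl x = ≋-reflexive refl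

  ≋-sym : ∀ {x y} → x ≋ y → y ≋ x
  ≋-sym {x} {y} (mod-p p∣x-y) = mod-p (subst (+ p ∣_) (identity x y) (∣m⇒∣-m p∣x-y))
    where
    identity : ∀ x y → - (x - y) ≡ y - x
    identity = solve-∀

  ≋-trans : ∀ {x y z} → x ≋ y → y ≋ z → x ≋ z
  ≋-trans {x} {y} {z} (mod-p p∣x-y) (mod-p p∣y-z) = mod-p (subst (+ p ∣_) (identity x y z) (∣m∣n⇒∣m+n p∣x-y p∣y-z))
    where
    identity : ∀ x y z → (x - y) + (y - z) ≡ x - z
    identity = solve-∀

  ≋-setoid : Setoid _ _
  ≋-setoid = record { Carrier = ℤ ; _≈_ = _≋_ ; isEquivalence = record { refl = ≋-refl _ ; sym = ≋-sym ; trans = ≋-trans } }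

  +-cong : ∀ {a b c d} → a ≋ b → c ≋ d → a + c ≋ b + d
  +-cong {a} {b} {c} {d} (mod-p p∣a-b) (mod-p p∣c-d) = mod-p (subst (+ p ∣_) (identity a b c d) (∣m∣n⇒∣m+n p∣a-b p∣c-d))
    where
    identity : ∀ a b c d → (a - b) + (c - d) ≡ (a + c) - (b + d)
    identity = solve-∀

  *-cong : ∀ {a b c d} → a ≋ b → c ≋ d → a * c ≋ b * d
  *-cong {a} {b} {c} {d} (mod-p p∣a-b) (mod-p p∣c-d) =
    mod-p (subst (+ p ∣_) (identity a b c d) (∣m∣n⇒∣m+n (∣n⇒∣m*n c p∣a-b) (∣n⇒∣m*n b p∣c-d)))
    where
    identity : ∀ a b c d → c * (a - b) + b * (c - d) ≡ a * c - b * d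
    identity = solve-∀

  ^-cong : ∀ {a b} n → a ≋ b → a ^ n ≋ b ^ n
  ^-cong zero    _   = ≋-refl (+ 1)
  ^-cong (suc n) a≋b = *-cong a≋b (^-cong n a≋b)

  ∣⇒≋0 : ∀ {x} → + p ∣ x → x ≋ + 0
  ∣⇒≋0 {x} p∣x = mod-p (subst (+ p ∣_) (sym (ℤ.+-identityʳ x)) p∣x)

  ≋0⇒∣ : ∀ {x} → x ≋ + 0 → + p ∣ x
  ≋0⇒∣ {x} (mod-p p∣x-0) = subst (+ p ∣_) (ℤ.+-identityʳ x) p∣x-0

  ≋-residue : ∀ y .{{_ : ℕ.NonZero p}} → y ≋ + (y ℤ.%ℕ p)
  ≋-residue y = mod-p (divides (y ℤ./ℕ p) (trans (cong (_- + (y ℤ.%ℕ p)) (ℤ.a≡a%ℕn+[a/ℕn]*n y p)) (identity (+ (y ℤ.%ℕ p)) _)))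
    where
    identity : ∀ r q → r + q - r ≡ q
    identity = solve-∀

pos-^ : ∀ a n → (+ a) ^ n ≡ + (a ℕ.^ n)
pos-^ a zero    = refl
pos-^ a (suc n) = trans (cong (+ a *_) (pos-^ a n)) (sym (ℤ.pos-* a (a ℕ.^ n)))

module Fermat {q : ℕ} (p-prime : Prime (suc q)) where

  p : ℕ
  p = suc q

  open Modulo p

  p∤1 : ¬ p ℕ.∣ 1
  p∤1 p∣1 with ℕ.∣1⇒≡1 p∣1 | prime⇒nonTrivial p-prime
  ... | refl | ()

  p∤k! : ∀ k → k ℕ.< p → ¬ p ℕ.∣ k !
  p∤k! zero    _   = p∤1
  p∤k! (suc k) k<p p∣k! with euclidsLemma (suc k) (k !) p-prime p∣k!
  ... | inj₁ p∣1+k = ℕ.<⇒≱ k<p (ℕ.∣⇒≤ p∣1+k)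
  ... | inj₂ p∣k!  = p∤k! k (ℕ.<-trans (ℕ.n<1+n k) k<p) p∣k!

  p∣pCk : ∀ k → 0 ℕ.< k → k ℕ.< p → p ℕ.∣ p C k
  p∣pCk k 0<k k<p with euclidsLemma (p C k) (k ! ℕ.* (p ℕ.∸ k) !) p-prime p∣product
    where
    k≤p = ℕ.<⇒≤ k<p
    p∣product : p ℕ.∣ (p C k) ℕ.* (k ! ℕ.* (p ℕ.∸ k) !)
    p∣product = subst (p ℕ.∣_) (sym (trans (cong (ℕ._* (k ! ℕ.* (p ℕ.∸ k) !)) (nCk≡n!/k![n-k]! k≤p))
      (ℕ.m/n*n≡m {{ℕ._!*_!≢0 k (p ℕ.∸ k)}} (k![n∸k]!∣n! k≤p)))) (ℕ.m∣m*n (q !))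
  ... | inj₁ p∣pCk = p∣pCk
  ... | inj₂ p∣k![p-k]! with euclidsLemma (k !) ((p ℕ.∸ k) !) p-prime p∣k![p-k]!
  ...   | inj₁ p∣k!     = ⊥-elim (p∤k! k k<p p∣k!)
  ...   | inj₂ p∣[p-k]! = ⊥-elim (p∤k! (p ℕ.∸ k) (ℕ.∸-monoʳ-< {p} {k} {0} 0<k (ℕ.<⇒≤ k<p)) p∣[p-k]!)

  partial-binomial≡1 : ∀ x k → k ℕ.< p → ∃[ c ] (partial-binomial p x (suc k) ≡ 1 ℕ.+ p ℕ.* c)
  partial-binomial≡1 x zero    _   rewrite nC0≡1 p = 0 , sym (cong (1 ℕ.+_) (ℕ.*-zeroʳ p))
  partial-binomial≡1 x (suc k) k<p with partial-binomial≡1 x k (ℕ.<-trans (ℕ.n<1+n k) k<p) | p∣pCk (suc k) (ℕ.s≤s ℕ.z≤n) k<p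
  ... | c , eq | ℕ.divides d pCk≡dp = c ℕ.+ d ℕ.* x ℕ.^ suc k ,
        trans (cong₂ (λ u v → u ℕ.+ v ℕ.* x ℕ.^ suc k) eq pCk≡dp) (regroup c d (x ℕ.^ suc k) p)
    where
    regroup : ∀ c d y p → 1 ℕ.+ p ℕ.* c ℕ.+ d ℕ.* p ℕ.* y ≡ 1 ℕ.+ p ℕ.* (c ℕ.+ d ℕ.* y)
    regroup = ℕ-Solver.solve-∀

  freshman's-dream : ∀ x → ∃[ c ] ((x ℕ.+ 1) ℕ.^ p ≡ x ℕ.^ p ℕ.+ 1 ℕ.+ p ℕ.* c)
  freshman's-dream x with partial-binomial≡1 x q (ℕ.n<1+n q)
  ... | c , eq = c , trans (binomial-theorem p x) (trans (cong₂ (λ u v → u ℕ.+ v ℕ.* x ℕ.^ p) eq (nCn≡1 p)) (regroup c (x ℕ.^ p) p))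
    where
    regroup : ∀ c y p → 1 ℕ.+ p ℕ.* c ℕ.+ 1 ℕ.* y ≡ y ℕ.+ 1 ℕ.+ p ℕ.* c
    regroup = ℕ-Solver.solve-∀

  fermatℕ : ∀ a → ∃[ c ] (a ℕ.^ p ≡ a ℕ.+ p ℕ.* c)
  fermatℕ zero = 0 , sym (ℕ.*-zeroʳ p)
  fermatℕ (suc a) with fermatℕ a | freshman's-dream a
  ... | c₀ , a^p≡ | c₁ , [a+1]^p≡ = c₀ ℕ.+ c₁ ,
        trans (cong (ℕ._^ p) (ℕ.+-comm 1 a)) (trans [a+1]^p≡ (trans (cong (λ z → z ℕ.+ 1 ℕ.+ p ℕ.* c₁) a^p≡) (regroup a c₀ c₁ p)))
    where
    regroup : ∀ a c₀ c₁ p → a ℕ.+ p ℕ.* c₀ ℕ.+ 1 ℕ.+ p ℕ.* c₁ ≡ suc a ℕ.+ p ℕ.* (c₀ ℕ.+ c₁)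
    regroup = ℕ-Solver.solve-∀

  fermat : ∀ y → y ^ p ≋ y
  fermat y = ≋-trans (^-cong p y≋r) (≋-trans (small (y ℤ.%ℕ p)) (≋-sym y≋r))
    where
    y≋r = ≋-residue y
    small : ∀ a → (+ a) ^ p ≋ + a
    small a with fermatℕ a
    ... | c , a^p≡ = mod-p (divides (+ c) (begin
      (+ a) ^ p - + a            ≡⟨ cong (_- + a) (trans (pos-^ a p) (cong +_ a^p≡)) ⟩
      + (a ℕ.+ p ℕ.* c) - + a    ≡⟨ cong (_- + a) (trans (ℤ.pos-+ a (p ℕ.* c)) (cong (λ z → + a + z) (ℤ.pos-* p c))) ⟩
      + a + + p * + c - + a      ≡⟨ identity (+ a) (+ p) (+ c) ⟩
      + c * + p                  ∎))
      where
      open ≡-Reasoning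
      identity : ∀ a p c → a + p * c - a ≡ c * p
      identity = solve-∀

prime-∣-* : ∀ {p} → Prime p → ∀ x y → + p ∣ x * y → (+ p ∣ x) ⊎ (+ p ∣ y)
prime-∣-* p-prime x y p∣xy with euclidsLemma ℤ.∣ x ∣ ℤ.∣ y ∣ p-prime (subst (_ ℕ.∣_) (ℤ.abs-* x y) (∣⇒∣ᵤ p∣xy))
... | inj₁ p∣x = inj₁ (∣ᵤ⇒∣ p∣x)
... | inj₂ p∣y = inj₂ (∣ᵤ⇒∣ p∣y)

3j+2∤3 : ∀ j → ¬ suc (3 ℕ.* j ℕ.+ 1) ℕ.∣ 3
3j+2∤3 zero    (ℕ.divides (suc (suc _)) ())
3j+2∤3 zero    (ℕ.divides (suc zero) ())
3j+2∤3 zero    (ℕ.divides zero ())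
3j+2∤3 (suc j) p∣3 = 5≰3 (ℕ.≤-trans (ℕ.s≤s (ℕ.+-monoˡ-≤ 1 (ℕ.*-monoʳ-≤ 3 (ℕ.s≤s (ℕ.z≤n {j}))))) (ℕ.∣⇒≤ p∣3))
  where
  5≰3 : ¬ 5 ℕ.≤ 3
  5≰3 (ℕ.s≤s (ℕ.s≤s (ℕ.s≤s ())))

-- A prime p ≡ 2 (mod 3) has no primitive cube root of unity, since 3 ∤ p - 1.
module PrimeTwoModThree {j : ℕ} (p-prime : Prime (suc (3 ℕ.* j ℕ.+ 1))) where

  open Fermat p-prime
  open Modulo p
  open import Relation.Binary.Reasoning.Setoid ≋-setoid

  1≋0-absurd : ¬ (+ 1 ≋ + 0)
  1≋0-absurd 1≋0 = p∤1 (∣⇒∣ᵤ (≋0⇒∣ 1≋0))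

  3≋0-absurd : ¬ (+ 3 ≋ + 0)
  3≋0-absurd 3≋0 = 3j+2∤3 j (∣⇒∣ᵤ (≋0⇒∣ 3≋0))

  cube≋1 : ∀ u → u * u + u + + 1 ≋ + 0 → u * u * u ≋ + 1
  cube≋1 u S≋0 = begin
    u * u * u                                  ≡⟨ factor u ⟩
    (u - + 1) * (u * u + u + + 1) + + 1        ≈⟨ +-cong (*-cong (≋-refl (u - + 1)) S≋0) (≋-refl (+ 1)) ⟩
    (u - + 1) * + 0 + + 1                      ≡⟨ cancel u ⟩
    + 1                                        ∎
    where
    factor : ∀ u → u * u * u ≡ (u - + 1) * (u * u + u + + 1) + + 1
    factor = solve-∀
    cancel : ∀ u → (u - + 1) * + 0 + + 1 ≡ + 1
    cancel = solve-∀

  ^3k≋1 : ∀ u → u * u * u ≋ + 1 → ∀ k → u ^ (3 ℕ.* k) ≋ + 1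
  ^3k≋1 u u³≋1 zero    = ≋-refl (+ 1)
  ^3k≋1 u u³≋1 (suc k) = begin
    u ^ (3 ℕ.* suc k)            ≡⟨ cong (u ^_) (ℕ.*-suc 3 k) ⟩
    u ^ (3 ℕ.+ 3 ℕ.* k)          ≡⟨ ℤ.^-distribˡ-+-* u 3 (3 ℕ.* k) ⟩
    u ^ 3 * u ^ (3 ℕ.* k)        ≈⟨ *-cong (≋-trans (≋-reflexive (cube u)) u³≋1) (^3k≋1 u u³≋1 k) ⟩
    + 1 * + 1                    ≡⟨⟩
    + 1                          ∎
    where
    cube : ∀ u → u * (u * (u * + 1)) ≡ u * u * u
    cube = solve-∀

  no-primitive-cube-root : ∀ u → ¬ (u * u + u + + 1 ≋ + 0)
  no-primitive-cube-root u S≋0 = by-cases (prime-∣-* p-prime u (u - + 1) p∣u[u-1])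
    where
    u^p≋u² : u ^ p ≋ u * u
    u^p≋u² = begin
      u * u ^ (3 ℕ.* j ℕ.+ 1)        ≡⟨ cong (u *_) (ℤ.^-distribˡ-+-* u (3 ℕ.* j) 1) ⟩
      u * (u ^ (3 ℕ.* j) * u ^ 1)    ≈⟨ *-cong (≋-refl u) (*-cong (^3k≋1 u (cube≋1 u S≋0) j) (≋-refl (u ^ 1))) ⟩
      u * (+ 1 * u ^ 1)              ≡⟨ simplify u ⟩
      u * u                          ∎
      where
      simplify : ∀ u → u * (+ 1 * (u * + 1)) ≡ u * u
      simplify = solve-∀
    p∣u[u-1] : + p ∣ u * (u - + 1)
    p∣u[u-1] = subst (+ p ∣_) (factor u) (difference (≋-trans (≋-sym u^p≋u²) (fermat u)))
      where
      factor : ∀ u → u * u - u ≡ u * (u - + 1)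
      factor = solve-∀
    S-at : ∀ {c} → u ≋ c → u * u + u + + 1 ≋ c * c + c + + 1
    S-at u≋c = +-cong (+-cong (*-cong u≋c u≋c) u≋c) (≋-refl (+ 1))
    by-cases : (+ p ∣ u) ⊎ (+ p ∣ u - + 1) → ⊥
    by-cases (inj₁ p∣u)   = 1≋0-absurd (≋-trans (≋-sym (S-at (∣⇒≋0 p∣u))) S≋0)
    by-cases (inj₂ p∣u-1) = 3≋0-absurd (≋-trans (≋-sym (S-at (mod-p p∣u-1))) S≋0)

  unit^[p-1]≋1 : ∀ b → ¬ + p ∣ b → b ^ (3 ℕ.* j ℕ.+ 1) ≋ + 1
  unit^[p-1]≋1 b p∤b = mod-p (by-cases (prime-∣-* p-prime b (b ^ (3 ℕ.* j ℕ.+ 1) - + 1)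
    (subst (+ p ∣_) (factor b (b ^ (3 ℕ.* j ℕ.+ 1))) (difference (fermat b)))))
    where
    factor : ∀ b v → b * v - b ≡ b * (v - + 1)
    factor = solve-∀
    by-cases : (+ p ∣ b) ⊎ (+ p ∣ b ^ (3 ℕ.* j ℕ.+ 1) - + 1) → + p ∣ b ^ (3 ℕ.* j ℕ.+ 1) - + 1
    by-cases (inj₁ p∣b)     = ⊥-elim (p∤b p∣b)
    by-cases (inj₂ p∣v-1)   = p∣v-1

  -- If p ∤ b then u = a b^(p-2), a representative of a/b, is a primitive cube root of unity.
  divides-norm : ∀ a b → + p ∣ a * a + a * b + b * b → (+ p ∣ a) × (+ p ∣ b)
  divides-norm a b p∣N = by-cases (+ p ∣? b)
    where
    open import Relation.Nullary using (Dec; yes; no)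
    w = b ^ (3 ℕ.* j)
    u = a * w
    p∣b⇒p∣a : + p ∣ b → + p ∣ a
    p∣b⇒p∣a p∣b = [ id , id ]′ (prime-∣-* p-prime a a (subst (+ p ∣_) (square a b) (∣m∣n⇒∣m-n p∣N (∣n⇒∣m*n (a + b) p∣b))))
      where
      square : ∀ a b → a * a + a * b + b * b - (a + b) * b ≡ a * a
      square = solve-∀
    S≋0 : ¬ + p ∣ b → u * u + u + + 1 ≋ + 0
    S≋0 p∤b = begin
      u * u + u + + 1                                         ≡⟨ pad u ⟩
      u * u + u * + 1 + + 1 * + 1                             ≈⟨ +-cong (+-cong (≋-refl (u * u)) (*-cong (≋-refl u) (≋-sym wb≋1))) (*-cong (≋-sym wb≋1) (≋-sym wb≋1)) ⟩
      u * u + u * (w * (b * + 1)) + (w * (b * + 1)) * (w * (b * + 1))  ≡⟨ sym (expand a b w) ⟩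
      w * w * (a * a + a * b + b * b)                         ≈⟨ *-cong (≋-refl (w * w)) (∣⇒≋0 p∣N) ⟩
      w * w * + 0                                             ≡⟨ ℤ.*-zeroʳ (w * w) ⟩
      + 0                                                     ∎
      where
      wb≋1 : w * (b * + 1) ≋ + 1
      wb≋1 = ≋-trans (≋-reflexive (sym (ℤ.^-distribˡ-+-* b (3 ℕ.* j) 1))) (unit^[p-1]≋1 b p∤b)
      pad : ∀ u → u * u + u + + 1 ≡ u * u + u * + 1 + + 1 * + 1
      pad = solve-∀
      expand : ∀ a b w → w * w * (a * a + a * b + b * b) ≡ a * w * (a * w) + a * w * (w * (b * + 1)) + (w * (b * + 1)) * (w * (b * + 1))
      expand = solve-∀
    by-cases : Dec (+ p ∣ b) → (+ p ∣ a) × (+ p ∣ b)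
    by-cases (yes p∣b) = p∣b⇒p∣a p∣b , p∣b
    by-cases (no p∤b)  = ⊥-elim (no-primitive-cube-root u (S≋0 p∤b))

prime-factor : ∀ n → 2 ℕ.≤ n → ∃[ p ] (Prime p × p ℕ.∣ n)
prime-factor (suc zero) (ℕ.s≤s ())
prime-factor n@(suc (suc _)) _ with factorise n
... | record { factors = p ∷ ps ; isFactorisation = n≡product ; factorsPrime = p-prime ∷ _ } =
  p , p-prime , subst (p ℕ.∣_) (sym n≡product) (ℕ.m∣m*n (product ps))
... | record { factors = [] ; isFactorisation = () }

prime-factor≡2-mod-3 : ∀ {p} d → Prime p → p ℕ.∣ ℤ.∣ d ∣ → No3Or6k+1Factor d → ∃[ j ] (p ≡ suc (3 ℕ.* j ℕ.+ 1))
prime-factor≡2-mod-3 {p} d p-prime p∣d (3∤d , 6k+1∤d) = by-residue (p ℕ.% 6) (p ℕ./ 6) (ℕ.m%n<n p 6) (ℕ.m≡m%n+[m/n]*n p 6)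
  where
  even⇒2 : 2 ℕ.∣ p → p ≡ 2
  even⇒2 2∣p with prime⇒irreducible p-prime 2∣p
  ... | inj₁ ()
  ... | inj₂ 2≡p = sym 2≡p
  by-residue : ∀ r q → r ℕ.< 6 → p ≡ r ℕ.+ q ℕ.* 6 → ∃[ j ] (p ≡ suc (3 ℕ.* j ℕ.+ 1))
  by-residue 0 q _ p≡ = ⊥-elim (2≢6q q (trans (sym (even⇒2 (ℕ.divides (q ℕ.* 3) (trans p≡ (identity q))))) p≡))
    where
    identity : ∀ q → q ℕ.* 6 ≡ q ℕ.* 3 ℕ.* 2
    identity = ℕ-Solver.solve-∀
    2≢6q : ∀ q → 2 ≢ q ℕ.* 6
    2≢6q zero    ()
    2≢6q (suc q) ()
  by-residue 1 q _ p≡ = ⊥-elim (6k+1∤d q (subst Prime p≡6q+1 p-prime) (subst (ℕ._∣ ℤ.∣ d ∣) p≡6q+1 p∣d))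
    where
    identity : ∀ q → 1 ℕ.+ q ℕ.* 6 ≡ 6 ℕ.* q ℕ.+ 1
    identity = ℕ-Solver.solve-∀
    p≡6q+1 = trans p≡ (identity q)
  by-residue 2 q _ p≡ = q ℕ.* 2 , trans p≡ (identity q)
    where
    identity : ∀ q → 2 ℕ.+ q ℕ.* 6 ≡ suc (3 ℕ.* (q ℕ.* 2) ℕ.+ 1)
    identity = ℕ-Solver.solve-∀
  by-residue 3 q _ p≡ with prime⇒irreducible p-prime (ℕ.divides (q ℕ.* 2 ℕ.+ 1) (trans p≡ (identity q)))
    where
    identity : ∀ q → 3 ℕ.+ q ℕ.* 6 ≡ (q ℕ.* 2 ℕ.+ 1) ℕ.* 3
    identity = ℕ-Solver.solve-∀
  ... | inj₁ ()
  ... | inj₂ 3≡p = ⊥-elim (3∤d (subst (ℕ._∣ ℤ.∣ d ∣) (sym 3≡p) p∣d))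
  by-residue 4 q _ p≡ = ⊥-elim (2≢4+6q q (trans (sym (even⇒2 (ℕ.divides (q ℕ.* 3 ℕ.+ 2) (trans p≡ (identity q))))) p≡))
    where
    identity : ∀ q → 4 ℕ.+ q ℕ.* 6 ≡ (q ℕ.* 3 ℕ.+ 2) ℕ.* 2
    identity = ℕ-Solver.solve-∀
    2≢4+6q : ∀ q → 2 ≢ 4 ℕ.+ q ℕ.* 6
    2≢4+6q zero    ()
    2≢4+6q (suc q) ()
  by-residue 5 q _ p≡ = q ℕ.* 2 ℕ.+ 1 , trans p≡ (identity q)
    where
    identity : ∀ q → 5 ℕ.+ q ℕ.* 6 ≡ suc (3 ℕ.* (q ℕ.* 2 ℕ.+ 1) ℕ.+ 1)
    identity = ℕ-Solver.solve-∀
  by-residue (suc (suc (suc (suc (suc (suc _)))))) _ (ℕ.s≤s (ℕ.s≤s (ℕ.s≤s (ℕ.s≤s (ℕ.s≤s (ℕ.s≤s ())))))) _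

-- Points of the plane spanned by an equilateral triangle

lin : ℤ[ω] → ℤ⁴ → ℤ⁴ → ℤ⁴
lin (a , b) R S = a · R ⊕ b · S

P′≡lin : ∀ m n R S → P′ m n R S ≡ lin (m , - n) R S
P′≡lin m n R@(_ ∷ _ ∷ _ ∷ _ ∷ []) S@(_ ∷ _ ∷ _ ∷ _ ∷ []) = componentwise (identity m n) R S
  where
  identity : ∀ m n r s → m * r - n * s ≡ m * r + - n * s
  identity = solve-∀

Q′≡lin : ∀ m n R S → Q′ m n R S ≡ lin (ρ (m , - n)) R S
Q′≡lin m n R@(_ ∷ _ ∷ _ ∷ _ ∷ []) S@(_ ∷ _ ∷ _ ∷ _ ∷ []) = componentwise (identity m n) R S
  where
  identity : ∀ m n r s → (m - n) * s + n * r ≡ - - n * r + (m + - n) * s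
  identity = solve-∀

Q′≡P′ : ∀ m n R S → Q′ m n R S ≡ P′ n (n - m) R S
Q′≡P′ m n R@(_ ∷ _ ∷ _ ∷ _ ∷ []) S@(_ ∷ _ ∷ _ ∷ _ ∷ []) = componentwise (identity m n) R S
  where
  identity : ∀ m n r s → (m - n) * s + n * r ≡ n * r - (n - m) * s
  identity = solve-∀

P′-scale : ∀ t a b R S → P′ (t * a) (t * b) R S ≡ t · P′ a b R S
P′-scale t a b R@(_ ∷ _ ∷ _ ∷ _ ∷ []) S@(_ ∷ _ ∷ _ ∷ _ ∷ []) = componentwise (identity t a b) R S
  where
  identity : ∀ t a b r s → t * a * r - t * b * s ≡ t * (a * r - b * s)
  identity = solve-∀

Q′-scale : ∀ t a b R S → Q′ (t * a) (t * b) R S ≡ t · Q′ a b R S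
Q′-scale t a b R@(_ ∷ _ ∷ _ ∷ _ ∷ []) S@(_ ∷ _ ∷ _ ∷ _ ∷ []) = componentwise (identity t a b) R S
  where
  identity : ∀ t a b r s → (t * a - t * b) * s + t * b * r ≡ t * ((a - b) * s + b * r)
  identity = solve-∀

lin-⊖ : ∀ x y R S → lin x R S ⊖ lin y R S ≡ lin (x ⊟ y) R S
lin-⊖ (a , b) (c , d) R@(_ ∷ _ ∷ _ ∷ _ ∷ []) S@(_ ∷ _ ∷ _ ∷ _ ∷ []) = componentwise (identity a b c d) R S
  where
  identity : ∀ a b c d r s → a * r + b * s - (c * r + d * s) ≡ (a - c) * r + (b - d) * s
  identity = solve-∀

lin-lin : ∀ u v x y R S → lin (u , v) (lin x R S) (lin y R S) ≡ lin (u ⊡ x ⊞ v ⊡ y) R S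
lin-lin u v (a , b) (c , d) R@(_ ∷ _ ∷ _ ∷ _ ∷ []) S@(_ ∷ _ ∷ _ ∷ _ ∷ []) = componentwise (identity u v a b c d) R S
  where
  identity : ∀ u v a b c d r s → u * (a * r + b * s) + v * (c * r + d * s) ≡ (u * a + v * c) * r + (u * b + v * d) * s
  identity = solve-∀

·-lin : ∀ t x R S → t · lin x R S ≡ lin (t ⊡ x) R S
·-lin t (a , b) R@(_ ∷ _ ∷ _ ∷ _ ∷ []) S@(_ ∷ _ ∷ _ ∷ _ ∷ []) = componentwise (identity t a b) R S
  where
  identity : ∀ t a b r s → t * (a * r + b * s) ≡ t * a * r + t * b * s
  identity = solve-∀

·-lin-comm : ∀ c x X Y → c · lin x X Y ≡ lin x (c · X) (c · Y)
·-lin-comm c (a , b) X@(_ ∷ _ ∷ _ ∷ _ ∷ []) Y@(_ ∷ _ ∷ _ ∷ _ ∷ []) = componentwise (identity c a b) X Y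
  where
  identity : ∀ c a b x y → c * (a * x + b * y) ≡ a * (c * x) + b * (c * y)
  identity = solve-∀

·-comm : ∀ c t X → c · (t · X) ≡ t · (c · X)
·-comm c t X@(_ ∷ _ ∷ _ ∷ _ ∷ []) = componentwise₁ (identity c t) X
  where
  identity : ∀ c t x → c * (t * x) ≡ t * (c * x)
  identity = solve-∀

·-⊖ : ∀ t X Y → t · (X ⊖ Y) ≡ t · X ⊖ t · Y
·-⊖ t X@(_ ∷ _ ∷ _ ∷ _ ∷ []) Y@(_ ∷ _ ∷ _ ∷ _ ∷ []) = componentwise (identity t) X Y
  where
  identity : ∀ t x y → t * (x - y) ≡ t * x - t * y
  identity = solve-∀

⊖≡lin : ∀ X Y → X ⊖ Y ≡ lin (+ 1 , - + 1) X Y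
⊖≡lin X@(_ ∷ _ ∷ _ ∷ _ ∷ []) Y@(_ ∷ _ ∷ _ ∷ _ ∷ []) = componentwise identity X Y
  where
  identity : ∀ x y → x - y ≡ + 1 * x + - + 1 * y
  identity = solve-∀

lin-first : ∀ c R S → c · R ≡ lin (c , + 0) R S
lin-first c R@(_ ∷ _ ∷ _ ∷ _ ∷ []) S@(_ ∷ _ ∷ _ ∷ _ ∷ []) = componentwise (identity c) R S
  where
  identity : ∀ c r s → c * r ≡ c * r + + 0 * s
  identity = solve-∀

lin-second : ∀ c R S → c · S ≡ lin (ρ (c , + 0)) R S
lin-second c R@(_ ∷ _ ∷ _ ∷ _ ∷ []) S@(_ ∷ _ ∷ _ ∷ _ ∷ []) = componentwise (identity c) R S
  where
  identity : ∀ c r s → c * s ≡ - + 0 * r + (c + + 0) * s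
  identity = solve-∀

divisible? : ∀ c {k} (V : Vec ℤ k) → Dec (∃[ X ] (map (c *_) X ≡ V))
divisible? c []      = yes ([] , refl)
divisible? c (v ∷ V) with c ∣? v | divisible? c V
... | yes (divides q v≡qc) | yes (X , cX≡V) = yes (q ∷ X , cong₂ _∷_ (trans (ℤ.*-comm c q) (sym v≡qc)) cX≡V)
... | no c∤v | _      = no λ { (x ∷ _ , eq) → c∤v (divides x (trans (sym (∷-injectiveˡ eq)) (ℤ.*-comm c x))) }
... | yes _  | no c∤V = no λ { (_ ∷ X , eq) → c∤V (X , ∷-injectiveʳ eq) }

⟨·,·⟩ : ∀ c d X Y → ⟨ c · X , d · Y ⟩ ≡ c * d * ⟨ X , Y ⟩
⟨·,·⟩ c d X Y = begin
  ⟨ c · X , d · Y ⟩     ≡⟨ ⟨·⟩ˡ c X (d · Y) ⟩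
  c * ⟨ X , d · Y ⟩     ≡⟨ cong (c *_) (trans (⟨⟩-comm X (d · Y)) (trans (⟨·⟩ˡ d Y X) (cong (d *_) (⟨⟩-comm Y X)))) ⟩
  c * (d * ⟨ X , Y ⟩)   ≡⟨ sym (ℤ.*-assoc c d _) ⟩
  c * d * ⟨ X , Y ⟩     ∎
  where open ≡-Reasoning

eqDist-cancel : ∀ t {X Y} → t ≢ + 0 → EqDist (t · X) (t · Y) → EqDist X Y
eqDist-cancel t {X} {Y} t≢0 (‖tX‖≡‖tY‖ , ‖tY‖≡‖tX⊖tY‖) = cancel ‖tX‖≡‖tY‖' , cancel ‖tY‖≡‖tX⊖tY‖'
  where
  cancel : ∀ {a b} → t * t * a ≡ t * t * b → a ≡ b
  cancel = *-cancelˡ (t * t) (*-≢0 t≢0 t≢0)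
  ‖tX‖≡‖tY‖' : t * t * ‖ X ‖² ≡ t * t * ‖ Y ‖²
  ‖tX‖≡‖tY‖' = trans (sym (‖·‖² t X)) (trans ‖tX‖≡‖tY‖ (‖·‖² t Y))
  ‖tY‖≡‖tX⊖tY‖' : t * t * ‖ Y ‖² ≡ t * t * ‖ X ⊖ Y ‖²
  ‖tY‖≡‖tX⊖tY‖' = trans (sym (‖·‖² t Y)) (trans ‖tY‖≡‖tX⊖tY‖ (trans (cong ‖_‖² (sym (·-⊖ t X Y))) (‖·‖² t (X ⊖ Y))))

≢O⇒0<‖‖² : ∀ {X} → X ≢ O → + 0 < ‖ X ‖²
≢O⇒0<‖‖² {X} X≢O = ℤ.≤∧≢⇒< (0≤‖‖² X) (X≢O ∘ ‖‖²≡0⇒≡O X ∘ sym)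

module Basis {P Q : ℤ⁴} (PQ : EqDist P Q) where

  e : ℤ
  e = ⟨ P , Q ⟩

  ‖P‖²≡2e : ‖ P ‖² ≡ + 2 * e
  ‖P‖²≡2e = sym (eqDist⇒2⟨⟩≡‖‖² {P} {Q} PQ)

  ‖Q‖²≡2e : ‖ Q ‖² ≡ + 2 * e
  ‖Q‖²≡2e = trans (sym (proj₁ PQ)) ‖P‖²≡2e

  ‖P⊖Q‖²≡2e : ‖ P ⊖ Q ‖² ≡ + 2 * e
  ‖P⊖Q‖²≡2e = trans (sym (proj₂ PQ)) ‖Q‖²≡2e

  ⟨lin,P⟩ : ∀ a b → ⟨ lin (a , b) P Q , P ⟩ ≡ e * (+ 2 * a + b)
  ⟨lin,P⟩ a b = begin
    ⟨ a · P ⊕ b · Q , P ⟩           ≡⟨ ⟨⊕⟩ˡ (a · P) (b · Q) P ⟩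
    ⟨ a · P , P ⟩ + ⟨ b · Q , P ⟩   ≡⟨ cong₂ _+_ (⟨·⟩ˡ a P P) (⟨·⟩ˡ b Q P) ⟩
    a * ⟨ P , P ⟩ + b * ⟨ Q , P ⟩   ≡⟨ cong₂ (λ p q → a * p + b * q) (sym (‖‖²≡⟨⟩ P)) (⟨⟩-comm Q P) ⟩
    a * ‖ P ‖² + b * e              ≡⟨ cong (λ p → a * p + b * e) ‖P‖²≡2e ⟩
    a * (+ 2 * e) + b * e           ≡⟨ identity a b e ⟩
    e * (+ 2 * a + b)               ∎
    where
    open ≡-Reasoning
    identity : ∀ a b e → a * (+ 2 * e) + b * e ≡ e * (+ 2 * a + b)
    identity = solve-∀

  ⟨lin,Q⟩ : ∀ a b → ⟨ lin (a , b) P Q , Q ⟩ ≡ e * (a + + 2 * b)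
  ⟨lin,Q⟩ a b = begin
    ⟨ a · P ⊕ b · Q , Q ⟩           ≡⟨ ⟨⊕⟩ˡ (a · P) (b · Q) Q ⟩
    ⟨ a · P , Q ⟩ + ⟨ b · Q , Q ⟩   ≡⟨ cong₂ _+_ (⟨·⟩ˡ a P Q) (⟨·⟩ˡ b Q Q) ⟩
    a * e + b * ⟨ Q , Q ⟩           ≡⟨ cong (λ q → a * e + b * q) (trans (sym (‖‖²≡⟨⟩ Q)) ‖Q‖²≡2e) ⟩
    a * e + b * (+ 2 * e)           ≡⟨ identity a b e ⟩
    e * (a + + 2 * b)               ∎
    where
    open ≡-Reasoning
    identity : ∀ a b e → a * e + b * (+ 2 * e) ≡ e * (a + + 2 * b)
    identity = solve-∀

  ⟨lin,lin⟩ : ∀ x y → ⟨ lin x P Q , lin y P Q ⟩ ≡ e * B x y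
  ⟨lin,lin⟩ (a , b) (c , d) = begin
    ⟨ lin (a , b) P Q , c · P ⊕ d · Q ⟩                           ≡⟨ ⟨⟩-comm (lin (a , b) P Q) (c · P ⊕ d · Q) ⟩
    ⟨ c · P ⊕ d · Q , lin (a , b) P Q ⟩                           ≡⟨ ⟨⊕⟩ˡ (c · P) (d · Q) _ ⟩
    ⟨ c · P , lin (a , b) P Q ⟩ + ⟨ d · Q , lin (a , b) P Q ⟩     ≡⟨ cong₂ _+_ (⟨·⟩ˡ c P _) (⟨·⟩ˡ d Q _) ⟩
    c * ⟨ P , lin (a , b) P Q ⟩ + d * ⟨ Q , lin (a , b) P Q ⟩     ≡⟨ cong₂ (λ p q → c * p + d * q) (trans (⟨⟩-comm P _) (⟨lin,P⟩ a b)) (trans (⟨⟩-comm Q _) (⟨lin,Q⟩ a b)) ⟩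
    c * (e * (+ 2 * a + b)) + d * (e * (a + + 2 * b))             ≡⟨ identity a b c d e ⟩
    e * B (a , b) (c , d)                                         ∎
    where
    open ≡-Reasoning
    identity : ∀ a b c d e → c * (e * (+ 2 * a + b)) + d * (e * (a + + 2 * b)) ≡ e * (+ 2 * a * c + a * d + b * c + + 2 * b * d)
    identity = solve-∀

  ‖lin‖² : ∀ x → ‖ lin x P Q ‖² ≡ + 2 * e * N x
  ‖lin‖² x = begin
    ‖ lin x P Q ‖²                ≡⟨ ‖‖²≡⟨⟩ (lin x P Q) ⟩
    ⟨ lin x P Q , lin x P Q ⟩     ≡⟨ ⟨lin,lin⟩ x x ⟩
    e * B x x                     ≡⟨ cong (e *_) (B-diag x) ⟩
    e * (+ 2 * N x)               ≡⟨ identity e (N x) ⟩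
    + 2 * e * N x                 ∎
    where
    open ≡-Reasoning
    identity : ∀ e n → e * (+ 2 * n) ≡ + 2 * e * n
    identity = solve-∀

  lin-ρ-eqDist : ∀ x → EqDist (lin x P Q) (lin (ρ x) P Q)
  lin-ρ-eqDist x =
    trans (‖lin‖² x) (trans (cong (+ 2 * e *_) (sym (N-ρ x))) (sym (‖lin‖² (ρ x)))) ,
    trans (‖lin‖² (ρ x)) (trans (cong (+ 2 * e *_) (trans (N-ρ x) (sym (N-ρ⁻¹ x))))
      (sym (trans (cong ‖_‖² (trans (lin-⊖ x (ρ x) P Q) (cong (λ z → lin z P Q) (⊟ρ≡ρ⁻¹ x)))) (‖lin‖² (ρ⁻¹ x)))))

  eqDist-P′Q′ : ∀ m n → EqDist (P′ m n P Q) (Q′ m n P Q)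
  eqDist-P′Q′ m n = subst₂ EqDist (sym (P′≡lin m n P Q)) (sym (Q′≡lin m n P Q)) (lin-ρ-eqDist (m , - n))

  ‖P′‖² : ∀ m n → ‖ P′ m n P Q ‖² ≡ ‖ P ⊖ Q ‖² * (m * m - m * n + n * n)
  ‖P′‖² m n = begin
    ‖ P′ m n P Q ‖²                    ≡⟨ cong ‖_‖² (P′≡lin m n P Q) ⟩
    ‖ lin (m , - n) P Q ‖²             ≡⟨ ‖lin‖² (m , - n) ⟩
    + 2 * e * N (m , - n)              ≡⟨ cong₂ _*_ (sym ‖P⊖Q‖²≡2e) (identity m n) ⟩
    ‖ P ⊖ Q ‖² * (m * m - m * n + n * n) ∎
    where
    open ≡-Reasoning
    identity : ∀ m n → m * m + m * - n + - n * - n ≡ m * m - m * n + n * n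
    identity = solve-∀

module Coordinates {P Q : ℤ⁴} (PQ : EqDist P Q) (P≢O : P ≢ O) where

  open Basis {P} {Q} PQ public

  e≢0 : e ≢ + 0
  e≢0 e≡0 = P≢O (‖‖²≡0⇒≡O P (trans ‖P‖²≡2e (cong (+ 2 *_) e≡0)))

  3*e≢0 : + 3 * e ≢ + 0
  3*e≢0 = *-≢0 {+ 3} {e} (λ ()) e≢0

  -- Scaled coordinates: the Gram matrix of P, Q is e [[2,1],[1,2]] of determinant 3e², so the
  -- points of the rational plane spanned by P and Q lying in ℤ⁴ have coordinates in (1/3e) ℤ².
  record Coord (X : ℤ⁴) (x : ℤ[ω]) : Set where
    constructor coord
    field scaled : (+ 3 * e) · X ≡ lin x P Q
  open Coord public

  coord-lin : ∀ {X Y x y} → Coord X x → Coord Y y → ∀ u v → Coord (lin (u , v) X Y) (u ⊡ x ⊞ v ⊡ y)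
  coord-lin {X} {Y} {x} {y} (coord 3*e*X≡x) (coord 3*e*Y≡y) u v = coord (begin
    (+ 3 * e) · lin (u , v) X Y                       ≡⟨ ·-lin-comm (+ 3 * e) (u , v) X Y ⟩
    lin (u , v) ((+ 3 * e) · X) ((+ 3 * e) · Y)       ≡⟨ cong₂ (lin (u , v)) 3*e*X≡x 3*e*Y≡y ⟩
    lin (u , v) (lin x P Q) (lin y P Q)               ≡⟨ lin-lin u v x y P Q ⟩
    lin (u ⊡ x ⊞ v ⊡ y) P Q                           ∎)
    where open ≡-Reasoning

  coord-scale : ∀ {X x} → Coord X x → ∀ t → Coord (t · X) (t ⊡ x)
  coord-scale {X} {x} (coord 3*e*X≡x) t = coord (begin
    (+ 3 * e) · (t · X)     ≡⟨ ·-comm (+ 3 * e) t X ⟩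
    t · ((+ 3 * e) · X)     ≡⟨ cong (t ·_) 3*e*X≡x ⟩
    t · lin x P Q           ≡⟨ ·-lin t x P Q ⟩
    lin (t ⊡ x) P Q         ∎)
    where open ≡-Reasoning

  coord-⊖ : ∀ {X Y x y} → Coord X x → Coord Y y → Coord (X ⊖ Y) (x ⊟ y)
  coord-⊖ {X} {Y} {x} {y} cX cY = subst₂ Coord (sym (⊖≡lin X Y)) (difference x y) (coord-lin cX cY (+ 1) (- + 1))
    where
    difference : ∀ x y → + 1 ⊡ x ⊞ - + 1 ⊡ y ≡ x ⊟ y
    difference (a , b) (c , d) = cong₂ _,_ (identity a c) (identity b d)
      where
      identity : ∀ a c → + 1 * a + - + 1 * c ≡ a - c
      identity = solve-∀

  coord-injective : ∀ {X Y x} → Coord X x → Coord Y x → X ≡ Y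
  coord-injective (coord 3*e*X≡x) (coord 3*e*Y≡x) = ·-cancelˡ (+ 3 * e) 3*e≢0 (trans 3*e*X≡x (sym 3*e*Y≡x))

  crd : ℤ⁴ → ℤ[ω]
  crd X = + 2 * ⟨ X , P ⟩ - ⟨ X , Q ⟩ , + 2 * ⟨ X , Q ⟩ - ⟨ X , P ⟩

  crd-of-multiple : ∀ c X x → c · X ≡ lin x P Q → c ⊡ crd X ≡ (+ 3 * e) ⊡ x
  crd-of-multiple c X (a , b) cX≡x = cong₂ _,_ first second
    where
    open ≡-Reasoning
    u = ⟨ X , P ⟩
    v = ⟨ X , Q ⟩
    cu : c * u ≡ e * (+ 2 * a + b)
    cu = trans (sym (⟨·⟩ˡ c X P)) (trans (cong (λ Z → ⟨ Z , P ⟩) cX≡x) (⟨lin,P⟩ a b))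
    cv : c * v ≡ e * (a + + 2 * b)
    cv = trans (sym (⟨·⟩ˡ c X Q)) (trans (cong (λ Z → ⟨ Z , Q ⟩) cX≡x) (⟨lin,Q⟩ a b))
    distrib : ∀ c u v → c * (+ 2 * u - v) ≡ + 2 * (c * u) - c * v
    distrib = solve-∀
    identity₁ : ∀ e a b → + 2 * (e * (+ 2 * a + b)) - e * (a + + 2 * b) ≡ + 3 * e * a
    identity₁ = solve-∀
    identity₂ : ∀ e a b → + 2 * (e * (a + + 2 * b)) - e * (+ 2 * a + b) ≡ + 3 * e * b
    identity₂ = solve-∀
    first : c * (+ 2 * u - v) ≡ + 3 * e * a
    first = begin
      c * (+ 2 * u - v)                                       ≡⟨ distrib c u v ⟩
      + 2 * (c * u) - c * v                                   ≡⟨ cong₂ (λ p q → + 2 * p - q) cu cv ⟩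
      + 2 * (e * (+ 2 * a + b)) - e * (a + + 2 * b)           ≡⟨ identity₁ e a b ⟩
      + 3 * e * a                                             ∎
    second : c * (+ 2 * v - u) ≡ + 3 * e * b
    second = begin
      c * (+ 2 * v - u)                                       ≡⟨ distrib c v u ⟩
      + 2 * (c * v) - c * u                                   ≡⟨ cong₂ (λ p q → + 2 * p - q) cv cu ⟩
      + 2 * (e * (a + + 2 * b)) - e * (+ 2 * a + b)           ≡⟨ identity₂ e a b ⟩
      + 3 * e * b                                             ∎

  coord≡crd : ∀ {X x} → Coord X x → x ≡ crd X
  coord≡crd {X} {x} (coord 3*e*X≡x) = sym (⊡-cancelˡ (+ 3 * e) 3*e≢0 (crd-of-multiple (+ 3 * e) X x 3*e*X≡x))

  coord-unique : ∀ {X x y} → Coord X x → Coord X y → x ≡ y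
  coord-unique cx cy = trans (coord≡crd cx) (sym (coord≡crd cy))

  inPlane⇒coord : ∀ {X} → InPlane P Q X → Coord X (crd X)
  inPlane⇒coord {X} (a , b , c , c≢0 , cX≡ab) = coord (·-cancelˡ c c≢0 (begin
    c · ((+ 3 * e) · X)           ≡⟨ ·-comm c (+ 3 * e) X ⟩
    (+ 3 * e) · (c · X)           ≡⟨ cong ((+ 3 * e) ·_) cX≡ab ⟩
    (+ 3 * e) · lin (a , b) P Q   ≡⟨ ·-lin (+ 3 * e) (a , b) P Q ⟩
    lin ((+ 3 * e) ⊡ (a , b)) P Q ≡⟨ cong (λ z → lin z P Q) (sym (crd-of-multiple c X (a , b) cX≡ab)) ⟩
    lin (c ⊡ crd X) P Q           ≡⟨ sym (·-lin c (crd X) P Q) ⟩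
    c · lin (crd X) P Q           ∎))
    where open ≡-Reasoning

  coord⇒inPlane : ∀ {X x} → Coord X x → InPlane P Q X
  coord⇒inPlane {x = a , b} (coord 3*e*X≡x) = a , b , + 3 * e , 3*e≢0 , 3*e*X≡x

  lin-injective : ∀ {x y} → lin x P Q ≡ lin y P Q → x ≡ y
  lin-injective {x} {y} x≡y = ⊡-cancelˡ (+ 3 * e) 3*e≢0 (coord-unique (coord (·-lin (+ 3 * e) x P Q))
    (coord (trans (cong ((+ 3 * e) ·_) x≡y) (·-lin (+ 3 * e) y P Q))))

  ⟨⟩-coords : ∀ {X Y x y} → Coord X x → Coord Y y → + 9 * e * ⟨ X , Y ⟩ ≡ B x y
  ⟨⟩-coords {X} {Y} {x} {y} (coord 3*e*X≡x) (coord 3*e*Y≡y) = *-cancelˡ e e≢0 (begin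
    e * (+ 9 * e * ⟨ X , Y ⟩)                ≡⟨ identity e ⟨ X , Y ⟩ ⟩
    + 3 * e * (+ 3 * e) * ⟨ X , Y ⟩          ≡⟨ sym (⟨·,·⟩ (+ 3 * e) (+ 3 * e) X Y) ⟩
    ⟨ (+ 3 * e) · X , (+ 3 * e) · Y ⟩        ≡⟨ cong₂ ⟨_,_⟩ 3*e*X≡x 3*e*Y≡y ⟩
    ⟨ lin x P Q , lin y P Q ⟩                ≡⟨ ⟨lin,lin⟩ x y ⟩
    e * B x y                                ∎)
    where
    open ≡-Reasoning
    identity : ∀ e z → e * (+ 9 * e * z) ≡ + 3 * e * (+ 3 * e) * z
    identity = solve-∀

  ‖‖²-coords : ∀ {X x} → Coord X x → + 9 * e * ‖ X ‖² ≡ + 2 * N x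
  ‖‖²-coords {X} {x} cX = trans (cong (+ 9 * e *_) (‖‖²≡⟨⟩ X)) (trans (⟨⟩-coords cX cX) (B-diag x))

  eqDist⇒coords : ∀ {X Y x y} → Coord X x → Coord Y y → EqDist X Y → N x ≡ N y × B x y ≡ N x
  eqDist⇒coords {X} {Y} {x} {y} cX cY XY@(‖X‖≡‖Y‖ , _) = Nx≡Ny , Bxy≡Nx
    where
    Nx≡Ny : N x ≡ N y
    Nx≡Ny = *-cancelˡ (+ 2) (λ ()) (trans (sym (‖‖²-coords cX)) (trans (cong (+ 9 * e *_) ‖X‖≡‖Y‖) (‖‖²-coords cY)))
    identity : ∀ e z → + 2 * (+ 9 * e * z) ≡ + 9 * e * (+ 2 * z)
    identity = solve-∀
    Bxy≡Nx : B x y ≡ N x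
    Bxy≡Nx = *-cancelˡ (+ 2) (λ ()) (trans (cong (+ 2 *_) (sym (⟨⟩-coords cX cY))) (trans (identity e ⟨ X , Y ⟩)
      (trans (cong (+ 9 * e *_) (eqDist⇒2⟨⟩≡‖‖² {X} {Y} XY)) (‖‖²-coords cX))))

  eqDist⇒rotation : ∀ {X Y x y} → Coord X x → Coord Y y → EqDist X Y → y ≡ ρ x ⊎ x ≡ ρ y
  eqDist⇒rotation {x = x} {y} cX cY XY = equal-norm⇒rotation x y (proj₁ (eqDist⇒coords cX cY XY)) (proj₂ (eqDist⇒coords cX cY XY))

  coord-ρ-eqDist : ∀ {X Y x} → Coord X x → Coord Y (ρ x) → EqDist X Y
  coord-ρ-eqDist {X} {Y} {x} (coord 3*e*X≡x) (coord 3*e*Y≡ρx) =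
    eqDist-cancel (+ 3 * e) {X} {Y} 3*e≢0 (subst₂ EqDist (sym 3*e*X≡x) (sym 3*e*Y≡ρx) (lin-ρ-eqDist x))

  coord-≢O : ∀ {X x} → Coord X x → x ≢ 0ω → X ≢ O
  coord-≢O {X} {x} cX x≢0 X≡O = x≢0 (N≡0⇒≡0ω x (*-cancelˡ (+ 2) (λ ()) (trans (sym (‖‖²-coords cX))
    (trans (cong (λ Z → + 9 * e * ‖ Z ‖²) X≡O) (ℤ.*-zeroʳ (+ 9 * e))))))

  lin-≢O : ∀ {x} → x ≢ 0ω → lin x P Q ≢ O
  lin-≢O {x} x≢0 x≡O = x≢0 (N≡0⇒≡0ω x (*-cancelˡ (+ 2 * e) (*-≢0 {+ 2} {e} (λ ()) e≢0)
    (trans (sym (‖lin‖² x)) (trans (cong ‖_‖² x≡O) (sym (ℤ.*-zeroʳ (+ 2 * e)))))))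

  -- The coordinates of the points X ∈ ℤ⁴ of the plane for which the apex Y of the equilateral
  -- triangle OXY obtained by rotating X through 60° lies in ℤ⁴ as well.
  Λ : ℤ[ω] → Set
  Λ x = (∃[ X ] Coord X x) × (∃[ Y ] Coord Y (ρ x))

  coord-⊠ : ∀ {X Y x} → Coord X x → Coord Y (ρ x) → ∀ κ → Coord (lin κ X Y) (κ ⊠ x)
  coord-⊠ {x = x} cX cY (k , l) = subst (Coord _) (sym (⊠≡⊡⊞⊡ρ k l x)) (coord-lin cX cY k l)

  coord-ρ² : ∀ {X Y x} → Coord X x → Coord Y (ρ x) → Coord (Y ⊖ X) (ρ (ρ x))
  coord-ρ² {x = x} cX cY = subst (Coord _) (sym (ρ² x)) (coord-⊖ cY cX)

  Λ-⊠ : ∀ κ {x} → Λ x → Λ (κ ⊠ x)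
  Λ-⊠ κ {x} ((X , cX) , (Y , cY)) =
    (lin κ X Y , coord-⊠ cX cY κ) ,
    (lin κ Y (Y ⊖ X) , subst (Coord _) (sym (ρ-⊠ κ x)) (coord-⊠ cY (coord-ρ² cX cY) κ))

  Λ-⊟ : ∀ {x y} → Λ x → Λ y → Λ (x ⊟ y)
  Λ-⊟ {x} {y} ((X , cX) , (Y , cY)) ((X′ , cX′) , (Y′ , cY′)) =
    (X ⊖ X′ , coord-⊖ cX cX′) , (Y ⊖ Y′ , subst (Coord _) (sym (ρ-⊟ x y)) (coord-⊖ cY cY′))

  coord? : ∀ x → Dec (∃[ X ] Coord X x)
  coord? x = map′ (λ (X , 3eX≡x) → X , coord 3eX≡x) (λ (X , cX) → X , scaled cX) (divisible? (+ 3 * e) (lin x P Q))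

  Λ? : Decidable Λ
  Λ? x = coord? x ×-dec coord? (ρ x)

  g₀ : ℤ[ω]
  g₀ = + 3 * e , + 0

  g₀≢0 : g₀ ≢ 0ω
  g₀≢0 = 3*e≢0 ∘ cong proj₁

  coord-P : Coord P g₀
  coord-P = coord (lin-first (+ 3 * e) P Q)

  coord-Q : Coord Q (ρ g₀)
  coord-Q = coord (lin-second (+ 3 * e) P Q)

  Λ-g₀ : Λ g₀
  Λ-g₀ = (P , coord-P) , (Q , coord-Q)

  module Generated {g R S} (cR : Coord R g) (cS : Coord S (ρ g)) (g≢0 : g ≢ 0ω)
                   (least : ∀ z → Λ z → z ≢ 0ω → N g ≤ N z) where

    coord-P′ : ∀ m n → Coord (P′ m n R S) ((m , - n) ⊠ g)
    coord-P′ m n = subst₂ Coord (sym (P′≡lin m n R S)) refl (coord-⊠ cR cS (m , - n))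

    coord-Q′ : ∀ m n → Coord (Q′ m n R S) (ρ ((m , - n) ⊠ g))
    coord-Q′ m n = subst₂ Coord (sym (Q′≡lin m n R S)) (sym (ρ-⊠ˡ (m , - n) g)) (coord-⊠ cR cS (ρ (m , - n)))

    generates : ∀ {X Y x} → Coord X x → Coord Y (ρ x) → ∃[ m ] ∃[ n ] ((X ≡ P′ m n R S) × (Y ≡ Q′ m n R S))
    generates {X} {Y} {x} cX cY = k , - l , coord-injective cX (subst (Coord _) (sym x≡) (coord-P′ k (- l))) ,
                                            coord-injective cY (subst (Coord _) (sym (cong ρ x≡)) (coord-Q′ k (- l)))
      where
      κ = proj₁ (least-norm-generates Λ-⊟ Λ-⊠ ((R , cR) , (S , cS)) g≢0 least ((X , cX) , (Y , cY)))
      k = proj₁ κ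
      l = proj₂ κ
      x≡ : x ≡ (k , - - l) ⊠ g
      x≡ = trans (proj₂ (least-norm-generates Λ-⊟ Λ-⊠ ((R , cR) , (S , cS)) g≢0 least ((X , cX) , (Y , cY))))
                 (cong (λ l′ → (k , l′) ⊠ g) (sym (ℤ.neg-involutive l)))

    all-generated : ∀ X Y → InPlane P Q X → InPlane P Q Y → Equilateral X Y → GeneratedBy R S X Y
    all-generated X Y X∈PQ Y∈PQ (XY , _) = by-rotation (eqDist⇒rotation cX cY XY)
      where
      cX = inPlane⇒coord X∈PQ
      cY = inPlane⇒coord Y∈PQ
      by-rotation : crd Y ≡ ρ (crd X) ⊎ crd X ≡ ρ (crd Y) → GeneratedBy R S X Y
      by-rotation (inj₁ y≡ρx) = map₂ (map₂ inj₁) (generates cX (subst (Coord Y) y≡ρx cY))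
      by-rotation (inj₂ x≡ρy) = map₂ (map₂ (inj₂ ∘ swap)) (generates cY (subst (Coord X) x≡ρy cX))

    minimal : MinimalIn P Q R S
    minimal = coord⇒inPlane cR , coord⇒inPlane cS ,
              (coord-ρ-eqDist cR cS , ≢O⇒0<‖‖² (coord-≢O cR g≢0)) , all-generated

  minimal-triangle : ∃[ R ] ∃[ S ] MinimalIn P Q R S
  minimal-triangle = from-least-norm (least-norm-element Λ? Λ-g₀ g₀≢0)
    where
    from-least-norm : ∃[ g ] (Λ g × g ≢ 0ω × (∀ z → Λ z → z ≢ 0ω → N g ≤ N z)) → ∃[ R ] ∃[ S ] MinimalIn P Q R S
    from-least-norm (g , ((R , cR) , (S , cS)) , g≢0 , least) = R , S , Generated.minimal cR cS g≢0 least

-- Irreducible and minimal triangles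

common-divisor⇒reducible : ∀ {t m n} R S → 2 ℕ.≤ t → + t ∣ m → + t ∣ n → ¬ Irreducible (P′ m n R S) (Q′ m n R S)
common-divisor⇒reducible {t} R S 2≤t (divides a m≡at) (divides b n≡bt) irreducible =
  irreducible (t , 2≤t , (P′ a b R S , scaled P′ P′-scale) , (Q′ a b R S , scaled Q′ Q′-scale))
  where
  scaled : ∀ F → (∀ t a b R S → F (t * a) (t * b) R S ≡ t · F a b R S) → F _ _ R S ≡ + t · F a b R S
  scaled F F-scale = trans (cong₂ (λ m n → F m n R S) (trans m≡at (ℤ.*-comm a (+ t))) (trans n≡bt (ℤ.*-comm b (+ t)))) (F-scale (+ t) a b R S)

gcd≢1⇒common-divisor : ∀ m n → gcd m n ≢ + 1 → ∃[ t ] (2 ℕ.≤ t × (+ t ∣ m) × (+ t ∣ n))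
gcd≢1⇒common-divisor m n gcd≢1 = by-value (ℕ.gcd ℤ.∣ m ∣ ℤ.∣ n ∣) refl
  where
  zero-divisible : ∀ {i} → i ≡ + 0 → + 2 ∣ i
  zero-divisible i≡0 = divides (+ 0) i≡0
  by-value : ∀ d → ℕ.gcd ℤ.∣ m ∣ ℤ.∣ n ∣ ≡ d → ∃[ t ] (2 ℕ.≤ t × (+ t ∣ m) × (+ t ∣ n))
  by-value zero gcd≡0 = 2 , ℕ.s≤s (ℕ.s≤s ℕ.z≤n) , zero-divisible (ℤ.gcd[i,j]≡0⇒i≡0 m n (cong +_ gcd≡0)) ,
                                                   zero-divisible (ℤ.gcd[i,j]≡0⇒j≡0 {m} (cong +_ gcd≡0))
  by-value (suc zero) gcd≡1 = ⊥-elim (gcd≢1 (cong +_ gcd≡1))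
  by-value (suc (suc k)) gcd≡d = suc (suc k) , ℕ.s≤s (ℕ.s≤s ℕ.z≤n) ,
    ∣ᵤ⇒∣ (subst (ℕ._∣ ℤ.∣ m ∣) gcd≡d (ℤ.gcd[i,j]∣i m n)) , ∣ᵤ⇒∣ (subst (ℕ._∣ ℤ.∣ n ∣) gcd≡d (ℤ.gcd[i,j]∣j m n))

irreducible⇒coprime : ∀ m n R S → Irreducible (P′ m n R S) (Q′ m n R S) → gcd m n ≡ + 1
irreducible⇒coprime m n R S irreducible = decidable-stable (gcd m n ℤ.≟ + 1) λ gcd≢1 →
  let (t , 2≤t , t∣m , t∣n) = gcd≢1⇒common-divisor m n gcd≢1 in common-divisor⇒reducible R S 2≤t t∣m t∣n irreducible

coprime⇒no-common-divisor : ∀ {t m n} → gcd m n ≡ + 1 → 2 ℕ.≤ t → + t ∣ m → + t ∣ n → ⊥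
coprime⇒no-common-divisor {t} {m} {n} gcd≡1 2≤t t∣m t∣n with ℕ.∣1⇒≡1 (subst (λ g → t ℕ.∣ ℤ.∣ g ∣) gcd≡1 (ℤ.gcd-greatest {m} {n} {+ t} (∣⇒∣ᵤ t∣m) (∣⇒∣ᵤ t∣n)))
... | refl with 2≤t
... | ℕ.s≤s ()

2≤t⇒+t≢0 : ∀ {t} → 2 ℕ.≤ t → + t ≢ + 0
2≤t⇒+t≢0 (ℕ.s≤s _) ()

·-≢O : ∀ t {X Z} → t · X ≡ Z → Z ≢ O → X ≢ O
·-≢O t {X} {Z} tX≡Z Z≢O X≡O = Z≢O (‖‖²≡0⇒≡O Z (begin
  ‖ Z ‖²             ≡⟨ cong ‖_‖² (sym tX≡Z) ⟩
  ‖ t · X ‖²         ≡⟨ ‖·‖² t X ⟩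
  t * t * ‖ X ‖²     ≡⟨ cong (λ Y → t * t * ‖ Y ‖²) X≡O ⟩
  t * t * + 0        ≡⟨ ℤ.*-zeroʳ (t * t) ⟩
  + 0                ∎))
  where open ≡-Reasoning

module _ {P Q : ℤ⁴} (PQ : EqDist P Q) (P≢O : P ≢ O) where

  open Coordinates PQ P≢O

  P′-divisible : ∀ {t m n} a b → P′ m n P Q ≡ + t · P′ a b P Q → (+ t ∣ m) × (+ t ∣ n)
  P′-divisible {t} {m} {n} a b P′≡tP′ =
    divides a (trans (cong proj₁ coords≡) (ℤ.*-comm (+ t) a)) ,
    divides b (trans (ℤ.neg-injective (cong proj₂ coords≡)) (ℤ.*-comm (+ t) b))
    where
    coords≡ : (m , - n) ≡ (+ t * a , - (+ t * b))
    coords≡ = lin-injective (trans (sym (P′≡lin m n P Q)) (trans P′≡tP′ (trans (sym (P′-scale (+ t) a b P Q)) (P′≡lin (+ t * a) (+ t * b) P Q))))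

  coprime⇒irreducible : ∀ m n → MinimalIn P Q P Q → gcd m n ≡ + 1 → Irreducible (P′ m n P Q) (Q′ m n P Q)
  coprime⇒irreducible m n (_ , _ , _ , generated) gcd≡1 (t , 2≤t , (X₀ , P′≡tX₀) , (Y₀ , Q′≡tY₀)) =
    by-generation (generated X₀ Y₀ X₀∈PQ Y₀∈PQ X₀Y₀)
    where
    t≢0 : + t ≢ + 0
    t≢0 = 2≤t⇒+t≢0 2≤t
    X₀∈PQ : InPlane P Q X₀
    X₀∈PQ = m , - n , + t , t≢0 , trans (sym P′≡tX₀) (P′≡lin m n P Q)
    Y₀∈PQ : InPlane P Q Y₀
    Y₀∈PQ = - - n , m - n , + t , t≢0 , trans (sym Q′≡tY₀) (Q′≡lin m n P Q)
    mn≢0 : (m , - n) ≢ 0ω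
    mn≢0 mn≡0 = 1≢0 (trans (sym gcd≡1) (trans (cong₂ gcd m≡0 n≡0) ℤ.gcd[0,0]≡0))
      where
      m≡0 = cong proj₁ mn≡0
      n≡0 = trans (sym (ℤ.neg-involutive n)) (cong -_ (cong proj₂ mn≡0))
      1≢0 : + 1 ≢ + 0
      1≢0 ()
    X₀Y₀ : Equilateral X₀ Y₀
    X₀Y₀ = eqDist-cancel (+ t) {X₀} {Y₀} t≢0 (subst₂ EqDist P′≡tX₀ Q′≡tY₀ (eqDist-P′Q′ m n)) ,
           ≢O⇒0<‖‖² (·-≢O (+ t) (sym P′≡tX₀) (subst (_≢ O) (sym (P′≡lin m n P Q)) (lin-≢O mn≢0)))
    by-generation : GeneratedBy P Q X₀ Y₀ → ⊥
    by-generation (a , b , inj₁ (X₀≡P′ , _)) =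
      let (t∣m , t∣n) = P′-divisible a b (trans P′≡tX₀ (cong (+ t ·_) X₀≡P′)) in coprime⇒no-common-divisor {t} {m} {n} gcd≡1 2≤t t∣m t∣n
    by-generation (a , b , inj₂ (X₀≡Q′ , _)) =
      let (t∣m , t∣n) = P′-divisible b (b - a) (trans P′≡tX₀ (cong (+ t ·_) (trans X₀≡Q′ (Q′≡P′ a b P Q)))) in coprime⇒no-common-divisor {t} {m} {n} gcd≡1 2≤t t∣m t∣n

module _ {P Q : ℤ⁴} (PQ : EqDist P Q) (P≢O : P ≢ O) where

  open Coordinates {P} {Q} PQ P≢O

  Λ-multiple⇒reducible : ∀ {t y} → 2 ℕ.≤ t → Λ y → g₀ ≡ + t ⊡ y → ¬ Irreducible P Q
  Λ-multiple⇒reducible {t} {y} 2≤t ((X , cX) , (Y , cY)) g₀≡ty irreducible = irreducible (t , 2≤t , (X , P≡tX) , (Y , Q≡tY))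
    where
    P≡tX : P ≡ + t · X
    P≡tX = coord-injective coord-P (subst (Coord _) (sym g₀≡ty) (coord-scale cX (+ t)))
    Q≡tY : Q ≡ + t · Y
    Q≡tY = coord-injective coord-Q (subst (Coord _) (sym (trans (cong ρ g₀≡ty) (ρ-⊡ (+ t) y))) (coord-scale cY (+ t)))

  ‖P⊖Q‖²-factor : ∀ {g R κ} → Coord R g → g₀ ≡ κ ⊠ g → ‖ P ⊖ Q ‖² ≡ N κ * ‖ R ‖²
  ‖P⊖Q‖²-factor {g} {R} {κ} cR g₀≡κg = *-cancelˡ (+ 9 * e) (*-≢0 {+ 9} {e} (λ ()) e≢0) (begin
    + 9 * e * ‖ P ⊖ Q ‖²       ≡⟨ cong (+ 9 * e *_) (trans (sym (proj₂ PQ)) (sym (proj₁ PQ))) ⟩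
    + 9 * e * ‖ P ‖²           ≡⟨ ‖‖²-coords coord-P ⟩
    + 2 * N g₀                 ≡⟨ cong (λ z → + 2 * N z) g₀≡κg ⟩
    + 2 * N (κ ⊠ g)            ≡⟨ cong (+ 2 *_) (N-⊠ κ g) ⟩
    + 2 * (N κ * N g)          ≡⟨ identity (N κ) (N g) ⟩
    N κ * (+ 2 * N g)          ≡⟨ cong (N κ *_) (sym (‖‖²-coords cR)) ⟩
    N κ * (+ 9 * e * ‖ R ‖²)   ≡⟨ identity′ (N κ) e (‖ R ‖²) ⟩
    + 9 * e * (N κ * ‖ R ‖²)   ∎)
    where
    open ≡-Reasoning
    identity : ∀ k g → + 2 * (k * g) ≡ k * (+ 2 * g)
    identity = solve-∀
    identity′ : ∀ k e r → k * (+ 9 * e * r) ≡ + 9 * e * (k * r)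
    identity′ = solve-∀

  prime-divisor⇒reducible : ∀ {g κ j} → Λ g → g₀ ≡ κ ⊠ g → Prime (suc (3 ℕ.* j ℕ.+ 1)) →
                            suc (3 ℕ.* j ℕ.+ 1) ℕ.∣ ∣ N κ ∣ → ¬ Irreducible P Q
  prime-divisor⇒reducible {g} {k , l} {j} Λg g₀≡κg p-prime p∣Nκ =
    Λ-multiple⇒reducible (ℕ.s≤s (ℕ.m≤n+m 1 (3 ℕ.* j))) (Λ-⊠ (a , b) Λg) g₀≡p[ab⊠g]
    where
    open PrimeTwoModThree {j} p-prime using (divides-norm)
    p = suc (3 ℕ.* j ℕ.+ 1)
    p∣k,l = divides-norm k l (∣ᵤ⇒∣ p∣Nκ)
    a = _∣_.quotient (proj₁ p∣k,l)
    b = _∣_.quotient (proj₂ p∣k,l)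
    κ≡p[ab] : (k , l) ≡ + p ⊡ (a , b)
    κ≡p[ab] = cong₂ _,_ (trans (_∣_.equality (proj₁ p∣k,l)) (ℤ.*-comm a (+ p)))
                        (trans (_∣_.equality (proj₂ p∣k,l)) (ℤ.*-comm b (+ p)))
    g₀≡p[ab⊠g] : g₀ ≡ + p ⊡ ((a , b) ⊠ g)
    g₀≡p[ab⊠g] = trans g₀≡κg (trans (cong (_⊠ g) κ≡p[ab]) (⊡-⊠ (+ p) (a , b) g))

  -- Every prime factor of N κ divides |PQ|² and so would be ≡ 2 (mod 3), making OPQ reducible.
  unit-quotient : ∀ {g R κ} → Irreducible P Q → No3Or6k+1Factor ‖ P ⊖ Q ‖² →
                  Coord R g → Λ g → g₀ ≡ κ ⊠ g → N κ ≡ + 1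
  unit-quotient {g} {R} {κ} irreducible no-factor cR Λg g₀≡κg = by-value ∣ N κ ∣ (sym (ℤ.0≤i⇒+∣i∣≡i (0≤N κ)))
    where
    n∣‖P⊖Q‖² : ∣ N κ ∣ ℕ.∣ ∣ ‖ P ⊖ Q ‖² ∣
    n∣‖P⊖Q‖² = subst (∣ N κ ∣ ℕ.∣_) (sym (trans (cong ∣_∣ (‖P⊖Q‖²-factor {g} {R} {κ} cR g₀≡κg)) (ℤ.abs-* (N κ) (‖ R ‖²)))) (ℕ.m∣m*n ∣ ‖ R ‖² ∣)
    prime-factor-absurd : ∀ {p} → Prime p → p ℕ.∣ ∣ N κ ∣ → ⊥
    prime-factor-absurd {p} p-prime p∣Nκ = two-mod-three (prime-factor≡2-mod-3 ‖ P ⊖ Q ‖² p-prime (ℕ.∣-trans p∣Nκ n∣‖P⊖Q‖²) no-factor)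
      where
      two-mod-three : ∃[ j ] (p ≡ suc (3 ℕ.* j ℕ.+ 1)) → ⊥
      two-mod-three (j , refl) = prime-divisor⇒reducible {g} {κ} {j} Λg g₀≡κg p-prime p∣Nκ irreducible
    by-value : ∀ n → N κ ≡ + n → N κ ≡ + 1
    by-value zero Nκ≡0 = ⊥-elim (g₀≢0 (N≡0⇒≡0ω g₀ (trans (cong N g₀≡κg) (trans (N-⊠ κ g) (trans (cong (_* N g) Nκ≡0) (ℤ.*-zeroˡ (N g)))))))
    by-value (suc zero) Nκ≡1 = Nκ≡1
    by-value n@(suc (suc _)) Nκ≡n = ⊥-elim (prime-factor-absurd p-prime (subst (p ℕ.∣_) (cong ∣_∣ (sym Nκ≡n)) p∣n))
      where
      factor = prime-factor n (ℕ.s≤s (ℕ.s≤s ℕ.z≤n))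
      p = proj₁ factor
      p-prime = proj₁ (proj₂ factor)
      p∣n = proj₂ (proj₂ factor)

  irreducible⇒minimal : Irreducible P Q → No3Or6k+1Factor ‖ P ⊖ Q ‖² → MinimalIn P Q P Q
  irreducible⇒minimal irreducible no-factor = from-least-norm (least-norm-element Λ? Λ-g₀ g₀≢0)
    where
    from-least-norm : ∃[ g ] (Λ g × g ≢ 0ω × (∀ z → Λ z → z ≢ 0ω → N g ≤ N z)) → MinimalIn P Q P Q
    from-least-norm (g , Λg@((R , cR) , _) , g≢0 , g-least) = Generated.minimal coord-P coord-Q g₀≢0 g₀-least
      where
      generated = least-norm-generates Λ-⊟ Λ-⊠ {g} Λg g≢0 g-least {g₀} Λ-g₀
      κ = proj₁ generated
      Ng₀≡Ng : N g₀ ≡ N g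
      Ng₀≡Ng = begin
        N g₀          ≡⟨ cong N (proj₂ generated) ⟩
        N (κ ⊠ g)     ≡⟨ N-⊠ κ g ⟩
        N κ * N g     ≡⟨ cong (_* N g) (unit-quotient {g} {R} {κ} irreducible no-factor cR Λg (proj₂ generated)) ⟩
        + 1 * N g     ≡⟨ ℤ.*-identityˡ (N g) ⟩
        N g           ∎
        where open ≡-Reasoning
      g₀-least : ∀ z → Λ z → z ≢ 0ω → N g₀ ≤ N z
      g₀-least z Λz z≢0 = subst (_≤ N z) (sym Ng₀≡Ng) (g-least z Λz z≢0)

proposition2p2 :
    (∀ (P Q : ℤ⁴) (m n : ℤ) → EqDist P Q →
      EqDist (P′ m n P Q) (Q′ m n P Q) ×
      (‖ P′ m n P Q ‖² ≡ ‖ P ⊖ Q ‖² * (m * m - m * n + n * n)))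
    ×
    (∀ (P Q : ℤ⁴) → EqDist P Q → P ≢ O → ∃[ R ] ∃[ S ] MinimalIn P Q R S)
    ×
    (∀ (P Q : ℤ⁴) (m n : ℤ) → EqDist P Q → P ≢ O →
      Irreducible (P′ m n P Q) (Q′ m n P Q) → gcd m n ≡ + 1)
    ×
    (∀ (P Q : ℤ⁴) (m n : ℤ) → EqDist P Q → P ≢ O →
      MinimalIn P Q P Q → gcd m n ≡ + 1 → Irreducible (P′ m n P Q) (Q′ m n P Q))
    ×
    (∀ (P Q : ℤ⁴) → EqDist P Q → P ≢ O → Irreducible P Q →
      No3Or6k+1Factor ‖ P ⊖ Q ‖² → MinimalIn P Q P Q)
proposition2p2 =
  (λ P Q m n PQ → Basis.eqDist-P′Q′ {P} {Q} PQ m n , Basis.‖P′‖² {P} {Q} PQ m n) ,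
  (λ P Q PQ P≢O → Coordinates.minimal-triangle {P} {Q} PQ P≢O) ,
  (λ P Q m n _ _ → irreducible⇒coprime m n P Q) ,
  (λ P Q m n PQ P≢O → coprime⇒irreducible {P} {Q} PQ P≢O m n) ,
  (λ P Q PQ P≢O → irreducible⇒minimal {P} {Q} PQ P≢O)
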